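{- For $n\ge1$, let $O_n$, $M_n$, $P_n$ be the spiro ortho-chain, meta-chain and para-chain with $n$ hexagons. Then \[ STN(O_n)=\frac{256(16^{n-1}-1)}{9}+\frac{25(n-1)}{3}+36,\quad STN(M_n)=\frac{325(13^{n-1}-1)}{9}+\frac{5(n-1)}{3}+36, \] \[ STN(P_n)=\frac{4800(12^{n-1}-1)}{121}-\frac{15(n-1)}{11}+36. \]
   Context: For a simple graph $G$, $STN(G)$ is the number of nonempty subtrees of $G$ (subgraphs that are trees, single vertices included). A spiro chain with $n$ hexagons consists of hexagons $H_1,\dots,H_n$ such that $H_i$ and $H_{i+1}$ share exactly one vertex $c_i$, non-consecutive hexagons are disjoint, and for $2\le i\le n-1$ the vertices $c_{i-1}\ne c_i$ are at distance $d_i\in\{1,2,3\}$ in $H_i$. The ortho-chain $O_n$ has all $d_i=1$, the meta-chain $M_n$ all $d_i=2$, the para-chain $P_n$ all $d_i=3$ (for $n\le2$ they coincide). -}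

module Defs where

open import Data.Nat using (ℕ; zero; suc; _+_; _*_; _∸_; _≡ᵇ_)
open import Data.Bool using (Bool; true; false; _∧_; _∨_; not; if_then_else_)
open import Data.List using (List; []; _∷_; _++_; map; concatMap; length; filter; upTo)
open import Data.Bool.ListAction using (all; any)
open import Data.Product using (_×_; _,_; proj₁; proj₂)
open import Relation.Nullary.Decidable using (yes; no)
open import Data.Bool.Properties using (T?)

-- Finite simple graphs: vertices 0 .. V-1, an explicit list of
-- (distinct, loop-free) edges given as unordered pairs {u , v}.

record Graph : Set where
  constructor mkGraph
  field
    V : ℕ
    E : List (ℕ × ℕ)
open Graph public

_∈ᵇ_ : ℕ → List ℕ → Bool
x ∈ᵇ xs = any (λ y → x ≡ᵇ y) xs

_≡ᴱ_ : ℕ × ℕ → ℕ × ℕ → Bool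
(a , b) ≡ᴱ (c , d) = (a ≡ᵇ c) ∧ (b ≡ᵇ d)

-- all sublists (= all subsets, when the list has no duplicates)
subsets : {A : Set} → List A → List (List A)
subsets [] = [] ∷ []
subsets (x ∷ xs) = let r = subsets xs in r ++ map (x ∷_) r

removeEdge : ℕ × ℕ → List (ℕ × ℕ) → List (ℕ × ℕ)
removeEdge e [] = []
removeEdge e (f ∷ fs) = if e ≡ᴱ f then removeEdge e fs else f ∷ removeEdge e fs

step : List (ℕ × ℕ) → List ℕ → List ℕ
step F R = R ++ concatMap (λ e → (if proj₁ e ∈ᵇ R then proj₂ e ∷ [] else [])
                                ++ (if proj₂ e ∈ᵇ R then proj₁ e ∷ [] else [])) F

reachWithin : ℕ → List (ℕ × ℕ) → ℕ → List ℕ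
reachWithin zero F x = x ∷ []
reachWithin (suc k) F x = step F (reachWithin k F x)

connectedᵇ : ℕ → List (ℕ × ℕ) → ℕ → ℕ → Bool
connectedᵇ k F x y = y ∈ᵇ reachWithin k F x

-- Subgraph (S , F) of a graph on V vertices is a tree:
--  * S nonempty,
--  * every edge of F has both endpoints in S  (so (S,F) is a graph),
--  * connected: every vertex of S is joined to a fixed vertex of S by a
--    path in F (paths have length < V, so walks of length ≤ V suffice),
--  * acyclic: no edge of F lies on a cycle, i.e. for no edge {u,v} ∈ F are
--    u and v still joined by a path in F with that edge removed.

isTreeᵇ : ℕ → List ℕ → List (ℕ × ℕ) → Bool
isTreeᵇ V [] F = false
isTreeᵇ V (x ∷ S) F =
  all (λ e → (proj₁ e ∈ᵇ (x ∷ S)) ∧ (proj₂ e ∈ᵇ (x ∷ S))) F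
  ∧ all (λ y → connectedᵇ V F x y) (x ∷ S)
  ∧ all (λ e → not (connectedᵇ V (removeEdge e F) (proj₁ e) (proj₂ e))) F

subgraphs : Graph → List (List ℕ × List (ℕ × ℕ))
subgraphs G = concatMap (λ S → map (S ,_) (subsets (E G))) (subsets (upTo (V G)))

-- STN(G): number of nonempty subtrees of G (single vertices included)
STN : Graph → ℕ
STN G = length (filter (λ p → T? (isTreeᵇ (V G) (proj₁ p) (proj₂ p))) (subgraphs G))

-- Hexagon H_k (k = 0 .. n-1) consists of an attachment vertex a_k and five
-- new vertices b_k, b_k+1, ..., b_k+4 with b_k = 1 + 5k, forming the cycle
--   a_k – b_k – b_k+1 – b_k+2 – b_k+3 – b_k+4 – a_k.
-- a_0 = 0, and the cut vertex shared by H_k and H_{k+1} is the vertex of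
-- H_k at distance d from a_k along the cycle, namely b_k + d - 1 = 5k + d.
-- So a_{k+1} = 5k + d, and d(c_{k-1}, c_k) = d in H_k for all inner hexagons.

hexEdges : ℕ → ℕ → List (ℕ × ℕ)
hexEdges a b = (a , b) ∷ (b , b + 1) ∷ (b + 1 , b + 2) ∷ (b + 2 , b + 3)
             ∷ (b + 3 , b + 4) ∷ (b + 4 , a) ∷ []

attach : ℕ → ℕ → ℕ
attach d zero = 0
attach d (suc k) = 5 * k + d

spiroChain : ℕ → ℕ → Graph
spiroChain d n = mkGraph (5 * n + 1)
  (concatMap (λ k → hexEdges (attach d k) (1 + 5 * k)) (upTo n))

O M P : ℕ → Graph
O n = spiroChain 1 n
M n = spiroChain 2 n
P n = spiroChain 3 n

module Submission where

-- A subtree is a single vertex or is determined by its nonempty edge set, so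
-- STN(G) = |V(G)| + N(G) with N(G) the number of edge sets spanning a tree.
-- Hexagon n+1 meets the first n hexagons of a spiro chain only in the cut
-- vertex c, so a subtree of the longer chain lies in the old chain, lies in
-- the new hexagon, or is the union of one subtree of each containing c.  A
-- hexagon has 30 subtrees with an edge, 20 through a given vertex and 16, 13,
-- 12 through two vertices at distance 1, 2, 3 (computed by evaluation, every
-- hexagon being a relabelled copy of a standard one).  With C_n the number of
-- subtrees of the chain through its last cut vertex this gives
-- N_{n+1} = N_n + 30 + 20 C_n and C_{n+1} = 20 + k C_n, k ∈ {16, 13, 12},
-- whose solutions are the stated closed forms.

open import Defs
open import Data.Bool using (Bool; true; false; _∧_; _∨_; not; if_then_else_; T)
open import Data.Bool.ListAction using (and; all; any)
open import Data.Bool.Properties using (T?; T-≡; T-not-≡; T-∧; ∨-assoc; ∧-assoc; ∧-identityʳ)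
open import Data.Empty using (⊥-elim)
open import Data.Nat using (ℕ; zero; suc; _+_; _*_; _∸_; _^_; _≤_; _<_; _≡ᵇ_; _≤ᵇ_; z≤n; s≤s; s≤s⁻¹)
import Data.Nat.Properties as ℕ
open import Data.Nat.Solver using (module +-*-Solver)
open import Data.List using (List; []; _∷_; _++_; map; concatMap; length; filter; null; upTo)
import Data.List.Properties as List
open import Data.List.Membership.Propositional using (_∈_; find)
open import Data.List.Membership.Propositional.Properties
  using (∈-++⁺ˡ; ∈-++⁺ʳ; ∈-++⁻; ∈-map⁺; ∈-map⁻; ∈-concat⁺′; ∈-concat⁻′; ∈-filter⁺; ∈-filter⁻; ∈-upTo⁺)
open import Data.List.Membership.DecPropositional ℕ._≟_ using (_∈?_)
open import Data.List.Relation.Binary.Subset.Propositional using (_⊆_)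
import Data.List.Relation.Unary.All as All
open import Data.List.Relation.Unary.All.Properties using (all⁺; all⁻; ¬All⇒Any¬)
open import Data.List.Relation.Unary.Any as Any using (here; there)
open import Data.List.Relation.Unary.Any.Properties using (any⁺; any⁻)
open import Data.List.Relation.Unary.AllPairs using (_∷_; tail)
open import Data.List.Relation.Unary.Unique.Propositional using (Unique)
open import Data.List.Relation.Unary.Unique.Propositional.Properties using (upTo⁺)
open import Data.Product using (∃; _×_; _,_; proj₁; proj₂)
open import Data.Sum using (_⊎_; inj₁; inj₂; swap)
open import Function using (_∘_; id)
open import Function.Bundles using (Equivalence)
open import Relation.Binary.PropositionalEquality
open import Relation.Nullary using (¬_; yes; no; ¬?)
open import Algebra.Properties.CommutativeSemigroup ℕ.+-commutativeSemigroup using (interchange)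

open +-*-Solver using (solve; _:+_; _:*_; _:=_; con)
open Equivalence using (to; from)
open ≡-Reasoning

∧-elimˡ : ∀ {a b} → T (a ∧ b) → T a
∧-elimˡ {a} = proj₁ ∘ to (T-∧ {a})

∧-elimʳ : ∀ {a b} → T (a ∧ b) → T b
∧-elimʳ {a} = proj₂ ∘ to (T-∧ {a})

∧-intro : ∀ {a b} → T a → T b → T (a ∧ b)
∧-intro ta tb = from T-∧ (ta , tb)

T-injective : ∀ {a b} → (T a → T b) → (T b → T a) → a ≡ b
T-injective {true}  {true}  _ _ = refl
T-injective {true}  {false} f _ = ⊥-elim (f _)
T-injective {false} {true}  _ g = ⊥-elim (g _)
T-injective {false} {false} _ _ = refl

T-false : ∀ {a} → ¬ T a → a ≡ false
T-false ¬a = T-injective ¬a (λ ())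

T-not⇒¬T : ∀ {a} → T (not a) → ¬ T a
T-not⇒¬T {true} ()

¬T⇒T-not : ∀ {a} → ¬ T a → T (not a)
¬T⇒T-not {a} ¬a = from T-not-≡ (T-false ¬a)

𝟙 : Bool → ℕ
𝟙 true  = 1
𝟙 false = 0

𝟙-∧ : ∀ a b → 𝟙 (a ∧ b) ≡ 𝟙 a * 𝟙 b
𝟙-∧ true  b = sym (ℕ.+-identityʳ (𝟙 b))
𝟙-∧ false b = refl

𝟙-mono : ∀ {a b} → (T a → T b) → 𝟙 a ≤ 𝟙 b
𝟙-mono {false}         _ = z≤n
𝟙-mono {true}  {true}  _ = s≤s z≤n
𝟙-mono {true}  {false} f = ⊥-elim (f _)

∈ᵇ⇒∈ : ∀ {x} xs → T (x ∈ᵇ xs) → x ∈ xs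
∈ᵇ⇒∈ {x} xs = Any.map (ℕ.≡ᵇ⇒≡ x _) ∘ any⁻ _ xs

∈⇒∈ᵇ : ∀ {x xs} → x ∈ xs → T (x ∈ᵇ xs)
∈⇒∈ᵇ {x} = any⁺ _ ∘ Any.map (ℕ.≡⇒≡ᵇ x _)

∈ᵇ-++ : ∀ x xs ys → (x ∈ᵇ (xs ++ ys)) ≡ (x ∈ᵇ xs) ∨ (x ∈ᵇ ys)
∈ᵇ-++ x []       ys = refl
∈ᵇ-++ x (y ∷ xs) ys = trans (cong ((x ≡ᵇ y) ∨_) (∈ᵇ-++ x xs ys)) (sym (∨-assoc (x ≡ᵇ y) _ _))

all⇒∀ : ∀ {A : Set} (p : A → Bool) {xs} → T (all p xs) → ∀ {y} → y ∈ xs → T (p y)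
all⇒∀ p t = All.lookup (all⁺ p _ t)

∀⇒all : ∀ {A : Set} (p : A → Bool) xs → (∀ {y} → y ∈ xs → T (p y)) → T (all p xs)
∀⇒all p xs h = all⁻ p (All.tabulate h)

¬all⇒∃ : ∀ {A : Set} (p : A → Bool) xs → ¬ T (all p xs) → ∃ λ y → y ∈ xs × ¬ T (p y)
¬all⇒∃ p xs ¬t = find (¬All⇒Any¬ (T? ∘ p) xs (¬t ∘ all⁻ p))

all-map : ∀ {A B : Set} (p : B → Bool) (g : A → B) xs → all p (map g xs) ≡ all (p ∘ g) xs
all-map p g xs = cong and (sym (List.map-∘ xs))

all-cong : ∀ {A : Set} {p q : A → Bool} → (∀ x → p x ≡ q x) → ∀ xs → all p xs ≡ all q xs
all-cong p≗q xs = cong and (List.map-cong p≗q xs)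

Unique⇒∉ : ∀ {x : ℕ} {xs} → Unique (x ∷ xs) → ¬ x ∈ xs
Unique⇒∉ (x∉xs ∷ _) x∈xs = All.lookup x∉xs x∈xs refl

infix 2 ∑
∑ : {A : Set} → List A → (A → ℕ) → ℕ
∑ []       f = 0
∑ (x ∷ xs) f = f x + ∑ xs f

syntax ∑ xs (λ x → e) = ∑[ x ∈ xs ] e

∑-++ : ∀ {A : Set} xs ys (g : A → ℕ) → ∑ (xs ++ ys) g ≡ ∑ xs g + ∑ ys g
∑-++ []       ys g = refl
∑-++ (x ∷ xs) ys g rewrite ∑-++ xs ys g = sym (ℕ.+-assoc (g x) _ _)

∑-map : ∀ {A B : Set} (h : A → B) xs (g : B → ℕ) → ∑ (map h xs) g ≡ ∑ xs (g ∘ h)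
∑-map h []       g = refl
∑-map h (x ∷ xs) g = cong (g (h x) +_) (∑-map h xs g)

∑-cong : ∀ {A : Set} xs {g h : A → ℕ} → (∀ {x} → x ∈ xs → g x ≡ h x) → ∑ xs g ≡ ∑ xs h
∑-cong []       g≗h = refl
∑-cong (x ∷ xs) g≗h = cong₂ _+_ (g≗h (here refl)) (∑-cong xs (g≗h ∘ there))

∑-zero : ∀ {A : Set} xs {g : A → ℕ} → (∀ {x} → x ∈ xs → g x ≡ 0) → ∑ xs g ≡ 0
∑-zero []       g≗0 = refl
∑-zero (x ∷ xs) g≗0 rewrite g≗0 (here refl) = ∑-zero xs (g≗0 ∘ there)

∑-+ : ∀ {A : Set} xs (g h : A → ℕ) → (∑[ x ∈ xs ] (g x + h x)) ≡ ∑ xs g + ∑ xs h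
∑-+ []       g h = refl
∑-+ (x ∷ xs) g h rewrite ∑-+ xs g h = interchange (g x) (h x) (∑ xs g) (∑ xs h)

∑-*ˡ : ∀ {A : Set} xs k (g : A → ℕ) → (∑[ x ∈ xs ] (k * g x)) ≡ k * ∑ xs g
∑-*ˡ []       k g = sym (ℕ.*-zeroʳ k)
∑-*ˡ (x ∷ xs) k g rewrite ∑-*ˡ xs k g = sym (ℕ.*-distribˡ-+ k (g x) _)

∑-*ʳ : ∀ {A : Set} xs k (g : A → ℕ) → (∑[ x ∈ xs ] (g x * k)) ≡ ∑ xs g * k
∑-*ʳ []       k g = refl
∑-*ʳ (x ∷ xs) k g rewrite ∑-*ʳ xs k g = sym (ℕ.*-distribʳ-+ k (g x) _)

∑-comm : ∀ {A B : Set} xs ys (h : A → B → ℕ) →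
         (∑[ x ∈ xs ] ∑[ y ∈ ys ] h x y) ≡ (∑[ y ∈ ys ] ∑[ x ∈ xs ] h x y)
∑-comm []       ys h = sym (∑-zero ys (λ _ → refl))
∑-comm (x ∷ xs) ys h rewrite ∑-comm xs ys h = sym (∑-+ ys (h x) (λ y → ∑[ x ∈ xs ] h x y))

∑-pairs : ∀ {A B : Set} xs ys (g : A × B → ℕ) →
          ∑ (concatMap (λ x → map (x ,_) ys) xs) g ≡ (∑[ x ∈ xs ] ∑[ y ∈ ys ] g (x , y))
∑-pairs []       ys g = refl
∑-pairs (x ∷ xs) ys g = trans (∑-++ (map (x ,_) ys) _ g) (cong₂ _+_ (∑-map (x ,_) ys g) (∑-pairs xs ys g))

length-filter : ∀ {A : Set} (P : A → Bool) xs → length (filter (T? ∘ P) xs) ≡ (∑[ x ∈ xs ] 𝟙 (P x))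
length-filter P []       = refl
length-filter P (x ∷ xs) with P x
... | true  = cong suc (length-filter P xs)
... | false = length-filter P xs

∑-+₃ : ∀ {A : Set} xs (g h k : A → ℕ) → (∑[ x ∈ xs ] (g x + h x + k x)) ≡ ∑ xs g + ∑ xs h + ∑ xs k
∑-+₃ xs g h k = trans (∑-+ xs (λ x → g x + h x) k) (cong (_+ ∑ xs k) (∑-+ xs g h))

subsets-⊆ : ∀ {A : Set} L {S : List A} → S ∈ subsets L → S ⊆ L
subsets-⊆ [] (here refl) ()
subsets-⊆ (x ∷ L) S∈ z∈S with ∈-++⁻ (subsets L) S∈
... | inj₁ q = there (subsets-⊆ L q z∈S)
... | inj₂ q with ∈-map⁻ (x ∷_) q
... | S′ , S′∈ , refl with z∈S
...   | here z≡x = here z≡x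
...   | there z∈S′ = there (subsets-⊆ L S′∈ z∈S′)

length-subsets : ∀ {A : Set} L {S : List A} → S ∈ subsets L → length S ≤ length L
length-subsets [] (here refl) = z≤n
length-subsets (x ∷ L) S∈ with ∈-++⁻ (subsets L) S∈
... | inj₁ q = ℕ.m≤n⇒m≤1+n (length-subsets L q)
... | inj₂ q with ∈-map⁻ (x ∷_) q
...   | S′ , S′∈ , refl = s≤s (length-subsets L S′∈)

subsets-map : ∀ {A B : Set} (g : A → B) L → subsets (map g L) ≡ map (map g) (subsets L)
subsets-map g []      = refl
subsets-map g (x ∷ L) rewrite subsets-map g L
  | List.map-++ (map g) (subsets L) (map (x ∷_) (subsets L))
  | sym (List.map-∘ {g = map g} {f = x ∷_} (subsets L))
  = cong (map (map g) (subsets L) ++_) (sym (List.map-∘ {g = g x ∷_} {f = map g} (subsets L)))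

∑-subsets-map : ∀ {A B : Set} (h : A → B) L (G : List B → ℕ) →
                ∑ (subsets (map h L)) G ≡ (∑[ S ∈ subsets L ] G (map h S))
∑-subsets-map h L G = trans (cong (λ Ls → ∑ Ls G) (subsets-map h L)) (∑-map (map h) (subsets L) G)

∑-subsets-++ : ∀ {A : Set} xs ys (h : List A → ℕ) →
               ∑ (subsets (xs ++ ys)) h ≡ (∑[ S ∈ subsets xs ] ∑[ S′ ∈ subsets ys ] h (S ++ S′))
∑-subsets-++ []       ys h = sym (ℕ.+-identityʳ _)
∑-subsets-++ (x ∷ xs) ys h
  rewrite ∑-++ (subsets (xs ++ ys)) (map (x ∷_) (subsets (xs ++ ys))) h
  | ∑-map (x ∷_) (subsets (xs ++ ys)) h
  | ∑-++ (subsets xs) (map (x ∷_) (subsets xs)) (λ S → ∑[ S′ ∈ subsets ys ] h (S ++ S′))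
  | ∑-map (x ∷_) (subsets xs) (λ S → ∑[ S′ ∈ subsets ys ] h (S ++ S′))
  | ∑-subsets-++ xs ys h | ∑-subsets-++ xs ys (h ∘ (x ∷_)) = refl

∑-subsets-null : ∀ {A : Set} (L : List A) → (∑[ S ∈ subsets L ] 𝟙 (null S)) ≡ 1
∑-subsets-null []      = refl
∑-subsets-null (x ∷ L)
  rewrite ∑-++ (subsets L) (map (x ∷_) (subsets L)) (𝟙 ∘ null)
  | ∑-map (x ∷_) (subsets L) (𝟙 ∘ null) | ∑-subsets-null L
  | ∑-zero (subsets L) {𝟙 ∘ null ∘ (x ∷_)} (λ _ → refl) = refl

vertices : List (ℕ × ℕ) → List ℕ
vertices []            = []
vertices ((u , v) ∷ F) = u ∷ v ∷ vertices F

vertices-++ : ∀ F G → vertices (F ++ G) ≡ vertices F ++ vertices G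
vertices-++ []            G = refl
vertices-++ ((u , v) ∷ F) G = cong (λ t → u ∷ v ∷ t) (vertices-++ F G)

fst∈vertices : ∀ {u v F} → (u , v) ∈ F → u ∈ vertices F
fst∈vertices {F = _ ∷ _} (here refl) = here refl
fst∈vertices {F = _ ∷ _} (there p)   = there (there (fst∈vertices p))

snd∈vertices : ∀ {u v F} → (u , v) ∈ F → v ∈ vertices F
snd∈vertices {F = _ ∷ _} (here refl) = there (here refl)
snd∈vertices {F = _ ∷ _} (there p)   = there (there (snd∈vertices p))

vertices⁻ : ∀ {z} F → z ∈ vertices F → ∃ λ e → e ∈ F × (z ≡ proj₁ e ⊎ z ≡ proj₂ e)
vertices⁻ ((u , v) ∷ F) (here refl)         = (u , v) , here refl , inj₁ refl
vertices⁻ ((u , v) ∷ F) (there (here refl)) = (u , v) , here refl , inj₂ refl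
vertices⁻ ((u , v) ∷ F) (there (there p))   =
  let e , e∈F , z∈e = vertices⁻ F p in e , there e∈F , z∈e

vertices-mono : ∀ {F G} → F ⊆ G → vertices F ⊆ vertices G
vertices-mono {F} F⊆G p with vertices⁻ F p
... | _ , e∈F , inj₁ refl = fst∈vertices (F⊆G e∈F)
... | _ , e∈F , inj₂ refl = snd∈vertices (F⊆G e∈F)

Adj : List (ℕ × ℕ) → ℕ → ℕ → Set
Adj F y z = (y , z) ∈ F ⊎ (z , y) ∈ F

Adj-sym : ∀ {F y z} → Adj F y z → Adj F z y
Adj-sym (inj₁ p) = inj₂ p
Adj-sym (inj₂ p) = inj₁ p

Adj-vertices : ∀ {F y z} → Adj F y z → y ∈ vertices F × z ∈ vertices F
Adj-vertices (inj₁ p) = fst∈vertices p , snd∈vertices p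
Adj-vertices (inj₂ p) = snd∈vertices p , fst∈vertices p

Adj-++ : ∀ {F G y z} → Adj (F ++ G) y z → Adj F y z ⊎ Adj G y z
Adj-++ {F} (inj₁ p) with ∈-++⁻ F p
... | inj₁ q = inj₁ (inj₁ q)
... | inj₂ q = inj₂ (inj₁ q)
Adj-++ {F} (inj₂ p) with ∈-++⁻ F p
... | inj₁ q = inj₁ (inj₂ q)
... | inj₂ q = inj₂ (inj₂ q)

infixl 5 _▷_
data Walk (F : List (ℕ × ℕ)) (x : ℕ) : ℕ → Set where
  ε   : Walk F x x
  _▷_ : ∀ {y z} → Walk F x y → Adj F y z → Walk F x z

infixr 5 _++ʷ_
_++ʷ_ : ∀ {F x y z} → Walk F x y → Walk F y z → Walk F x z
w ++ʷ ε        = w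
w ++ʷ (w′ ▷ a) = (w ++ʷ w′) ▷ a

reverseʷ : ∀ {F x y} → Walk F x y → Walk F y x
reverseʷ ε       = ε
reverseʷ (w ▷ a) = (ε ▷ Adj-sym a) ++ʷ reverseʷ w

Walk-mono : ∀ {F G x y} → F ⊆ G → Walk F x y → Walk G x y
Walk-mono F⊆G ε            = ε
Walk-mono F⊆G (w ▷ inj₁ p) = Walk-mono F⊆G w ▷ inj₁ (F⊆G p)
Walk-mono F⊆G (w ▷ inj₂ p) = Walk-mono F⊆G w ▷ inj₂ (F⊆G p)

Walk-end : ∀ {F x y} → Walk F x y → x ≡ y ⊎ y ∈ vertices F
Walk-end ε       = inj₁ refl
Walk-end (w ▷ a) = inj₂ (proj₂ (Adj-vertices a))

Walk-ends : ∀ {F x y} → Walk F x y → x ≡ y ⊎ (x ∈ vertices F × y ∈ vertices F)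
Walk-ends w with Walk-end w | Walk-end (reverseʷ w)
... | inj₁ x≡y | _        = inj₁ x≡y
... | inj₂ _   | inj₁ y≡x = inj₁ (sym y≡x)
... | inj₂ y∈F | inj₂ x∈F = inj₂ (x∈F , y∈F)

edgeNeighbours : List ℕ → ℕ × ℕ → List ℕ
edgeNeighbours R e = (if proj₁ e ∈ᵇ R then proj₂ e ∷ [] else [])
                  ++ (if proj₂ e ∈ᵇ R then proj₁ e ∷ [] else [])

neighbours : List (ℕ × ℕ) → List ℕ → List ℕ
neighbours F R = concatMap (edgeNeighbours R) F

∈-if⁻ : ∀ b {x y : ℕ} → x ∈ (if b then y ∷ [] else []) → T b × x ≡ y
∈-if⁻ true (here x≡y) = _ , x≡y

∈-if⁺ : ∀ {b} {y : ℕ} → T b → y ∈ (if b then y ∷ [] else [])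
∈-if⁺ {true} _ = here refl

neighbours⁻ : ∀ F R {z} → z ∈ neighbours F R → ∃ λ y → y ∈ R × Adj F y z
neighbours⁻ F R p with ∈-concat⁻′ (map (edgeNeighbours R) F) p
... | _ , z∈N , N∈ with ∈-map⁻ (edgeNeighbours R) N∈
... | (u , v) , e∈F , refl with ∈-++⁻ (if u ∈ᵇ R then v ∷ [] else []) z∈N
...   | inj₁ q = let u∈R , z≡v = ∈-if⁻ (u ∈ᵇ R) q in u , ∈ᵇ⇒∈ R u∈R , inj₁ (subst (λ t → (u , t) ∈ F) (sym z≡v) e∈F)
...   | inj₂ q = let v∈R , z≡u = ∈-if⁻ (v ∈ᵇ R) q in v , ∈ᵇ⇒∈ R v∈R , inj₂ (subst (λ t → (t , v) ∈ F) (sym z≡u) e∈F)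

neighbours⁺ : ∀ F R {y z} → y ∈ R → Adj F y z → z ∈ neighbours F R
neighbours⁺ F R y∈R (inj₁ e∈F) =
  ∈-concat⁺′ (∈-++⁺ˡ (∈-if⁺ (∈⇒∈ᵇ y∈R))) (∈-map⁺ (edgeNeighbours R) e∈F)
neighbours⁺ F R y∈R (inj₂ e∈F) =
  ∈-concat⁺′ (∈-++⁺ʳ _ (∈-if⁺ (∈⇒∈ᵇ y∈R))) (∈-map⁺ (edgeNeighbours R) e∈F)

step⁻ : ∀ F R {z} → z ∈ step F R → z ∈ R ⊎ ∃ λ y → y ∈ R × Adj F y z
step⁻ F R p with ∈-++⁻ R p
... | inj₁ q = inj₁ q
... | inj₂ q = inj₂ (neighbours⁻ F R q)

step⁺ʳ : ∀ F R {y z} → y ∈ R → Adj F y z → z ∈ step F R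
step⁺ʳ F R y∈R a = ∈-++⁺ʳ R (neighbours⁺ F R y∈R a)

step-mono : ∀ F {R R′} → R ⊆ R′ → step F R ⊆ step F R′
step-mono F {R} {R′} R⊆R′ p with step⁻ F R p
... | inj₁ q             = ∈-++⁺ˡ (R⊆R′ q)
... | inj₂ (_ , y∈R , a) = step⁺ʳ F R′ (R⊆R′ y∈R) a

reachWithin-sound : ∀ k F x {z} → z ∈ reachWithin k F x → Walk F x z
reachWithin-sound zero    F x (here refl) = ε
reachWithin-sound (suc k) F x p with step⁻ F (reachWithin k F x) p
... | inj₁ q             = reachWithin-sound k F x q
... | inj₂ (_ , y∈R , a) = reachWithin-sound k F x y∈R ▷ a

reachWithin-complete : ∀ F x {z} → Walk F x z → ∃ λ k → z ∈ reachWithin k F x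
reachWithin-complete F x ε       = 0 , here refl
reachWithin-complete F x (w ▷ a) =
  let k , p = reachWithin-complete F x w in suc k , step⁺ʳ F (reachWithin k F x) p a

reachWithin-suc : ∀ k F x → reachWithin k F x ⊆ reachWithin (suc k) F x
reachWithin-suc k F x = ∈-++⁺ˡ

reachWithin-mono : ∀ {k K} F x → k ≤ K → reachWithin k F x ⊆ reachWithin K F x
reachWithin-mono F x k≤K p with ℕ.m≤n⇒m<n∨m≡n k≤K
... | inj₂ refl = p
reachWithin-mono {K = suc K} F x k≤K p | inj₁ (s≤s k≤K′) =
  reachWithin-suc K F x (reachWithin-mono F x k≤K′ p)

countIn : List ℕ → List ℕ → ℕ
countIn W R = ∑[ w ∈ W ] 𝟙 (w ∈ᵇ R)

countIn-≤-length : ∀ W R → countIn W R ≤ length W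
countIn-≤-length []      R = z≤n
countIn-≤-length (w ∷ W) R = ℕ.+-mono-≤ (𝟙-mono {b = true} _) (countIn-≤-length W R)

countIn-mono : ∀ W {R R′} → R ⊆ R′ → countIn W R ≤ countIn W R′
countIn-mono []      R⊆R′ = z≤n
countIn-mono (w ∷ W) {R} R⊆R′ =
  ℕ.+-mono-≤ (𝟙-mono (λ t → ∈⇒∈ᵇ (R⊆R′ (∈ᵇ⇒∈ {w} R t)))) (countIn-mono W R⊆R′)

countIn-strict : ∀ W R R′ {y} → R ⊆ R′ →
                 y ∈ W → y ∈ R′ → ¬ y ∈ R → countIn W R < countIn W R′
countIn-strict (w ∷ W) R R′ R⊆R′ (here refl) y∈R′ y∉R
  rewrite T-false {w ∈ᵇ R} (y∉R ∘ ∈ᵇ⇒∈ R) | to T-≡ (∈⇒∈ᵇ y∈R′) = s≤s (countIn-mono W R⊆R′)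
countIn-strict (w ∷ W) R R′ R⊆R′ (there y∈W) y∈R′ y∉R =
  ℕ.+-mono-≤-< (𝟙-mono (λ t → ∈⇒∈ᵇ (R⊆R′ (∈ᵇ⇒∈ {w} R t)))) (countIn-strict W R R′ R⊆R′ y∈W y∈R′ y∉R)

module Saturation (F : List (ℕ × ℕ)) (x : ℕ) (W : List ℕ)
                  (F⊆W : vertices F ⊆ W) (x∈W : x ∈ W) where

  private
    R : ℕ → List ℕ
    R k = reachWithin k F x

  R⊆W : ∀ k → R k ⊆ W
  R⊆W k p with Walk-end (reachWithin-sound k F x p)
  ... | inj₁ refl = x∈W
  ... | inj₂ z∈F  = F⊆W z∈F

  stable : ∀ {k} → R (suc k) ⊆ R k → ∀ j → R j ⊆ R k
  stable {k} h zero    = reachWithin-mono {0} {k} F x z≤n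
  stable {k} h (suc j) p = h (step-mono F {R j} {R k} (stable {k} h j) p)

  grows-or-stable : ∀ k → k < countIn W (R k) ⊎ (∀ j → R j ⊆ R k)
  grows-or-stable zero = inj₁ (ℕ.≤-trans (s≤s z≤n) (countIn-strict W [] (R zero) (λ ()) x∈W (here refl) (λ ())))
  grows-or-stable (suc k) with grows-or-stable k
  ... | inj₂ stableₖ = inj₂ (λ j p → reachWithin-suc k F x (stableₖ j p))
  ... | inj₁ k<count with T? (all (_∈ᵇ R k) (R (suc k)))
  ...   | yes t = inj₂ (λ j p → reachWithin-suc k F x (stable {k} (λ q → ∈ᵇ⇒∈ (R k) (all⇒∀ (_∈ᵇ R k) t q)) j p))
  ...   | no ¬t =
    let y , y∈R′ , y∉R = ¬all⇒∃ (_∈ᵇ R k) (R (suc k)) ¬t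
    in inj₁ (ℕ.≤-trans (s≤s k<count)
             (countIn-strict W (R k) (R (suc k)) (reachWithin-suc k F x) (R⊆W (suc k) y∈R′) y∈R′ (y∉R ∘ ∈⇒∈ᵇ)))

  reachWithin-saturated : ∀ {K} → length W ≤ K → ∀ {z} → Walk F x z → z ∈ R K
  reachWithin-saturated {K} |W|≤K w with grows-or-stable (length W)
  ... | inj₁ |W|<count = ⊥-elim (ℕ.<⇒≱ |W|<count (countIn-≤-length W (R (length W))))
  ... | inj₂ stable′ = let k , p = reachWithin-complete F x w in
                       reachWithin-mono F x |W|≤K (stable′ k p)

Connected : List (ℕ × ℕ) → Set
Connected F = ∀ {u v} → u ∈ vertices F → v ∈ vertices F → Walk F u v

Acyclic : List (ℕ × ℕ) → Set
Acyclic F = ∀ {e} → e ∈ F → ¬ Walk (removeEdge e F) (proj₁ e) (proj₂ e)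

IsTree : List (ℕ × ℕ) → Set
IsTree F = Connected F × Acyclic F

removeEdge-⊆ : ∀ e F → removeEdge e F ⊆ F
removeEdge-⊆ e (g ∷ F) p with e ≡ᴱ g
... | true  = there (removeEdge-⊆ e F p)
removeEdge-⊆ e (g ∷ F) (here f≡g) | false = here f≡g
removeEdge-⊆ e (g ∷ F) (there p)  | false = there (removeEdge-⊆ e F p)

removeEdge-++ : ∀ e F G → removeEdge e (F ++ G) ≡ removeEdge e F ++ removeEdge e G
removeEdge-++ e []      G = refl
removeEdge-++ e (f ∷ F) G with e ≡ᴱ f
... | true  = removeEdge-++ e F G
... | false = cong (f ∷_) (removeEdge-++ e F G)

endpointsInᵇ : List ℕ → List (ℕ × ℕ) → Bool
endpointsInᵇ S F = all (λ e → (proj₁ e ∈ᵇ S) ∧ (proj₂ e ∈ᵇ S)) F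

reachesAllᵇ : ℕ → List (ℕ × ℕ) → ℕ → List ℕ → Bool
reachesAllᵇ V F x S = all (λ y → connectedᵇ V F x y) S

acyclicᵇ : ℕ → List (ℕ × ℕ) → Bool
acyclicᵇ V F = all (λ e → not (connectedᵇ V (removeEdge e F) (proj₁ e) (proj₂ e))) F

-- The bound |S|≤V lets the V-round searches of isTreeᵇ find every walk.
module _ (V x : ℕ) (S : List ℕ) (F : List (ℕ × ℕ)) (|S|≤V : length (x ∷ S) ≤ V) where

  private
    SpansFrom : Set
    SpansFrom = vertices F ⊆ x ∷ S × (∀ {z} → z ∈ x ∷ S → Walk F x z) × Acyclic F

  isTreeᵇ⇒ : T (isTreeᵇ V (x ∷ S) F) → SpansFrom
  isTreeᵇ⇒ t = F⊆S , reaches , acyclic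
    where
    ends : T (endpointsInᵇ (x ∷ S) F)
    ends = ∧-elimˡ {endpointsInᵇ (x ∷ S) F} t
    reach : T (reachesAllᵇ V F x (x ∷ S))
    reach = ∧-elimˡ {reachesAllᵇ V F x (x ∷ S)} (∧-elimʳ {endpointsInᵇ (x ∷ S) F} t)
    acyc : T (acyclicᵇ V F)
    acyc = ∧-elimʳ {reachesAllᵇ V F x (x ∷ S)} (∧-elimʳ {endpointsInᵇ (x ∷ S) F} t)
    F⊆S : vertices F ⊆ x ∷ S
    F⊆S p with vertices⁻ F p
    ... | (u , v) , e∈F , inj₁ refl = ∈ᵇ⇒∈ (x ∷ S) (∧-elimˡ {u ∈ᵇ (x ∷ S)} (all⇒∀ _ ends e∈F))
    ... | (u , v) , e∈F , inj₂ refl = ∈ᵇ⇒∈ (x ∷ S) (∧-elimʳ {u ∈ᵇ (x ∷ S)} (all⇒∀ _ ends e∈F))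
    reaches : ∀ {z} → z ∈ x ∷ S → Walk F x z
    reaches p = reachWithin-sound V F x (∈ᵇ⇒∈ (reachWithin V F x) (all⇒∀ (connectedᵇ V F x) reach p))
    acyclic : Acyclic F
    acyclic {e} e∈F w = T-not⇒¬T (all⇒∀ (λ e → not (connectedᵇ V (removeEdge e F) (proj₁ e) (proj₂ e))) acyc e∈F)
      (∈⇒∈ᵇ (Saturation.reachWithin-saturated (removeEdge e F) (proj₁ e) (x ∷ S)
               (λ p → F⊆S (vertices-mono (removeEdge-⊆ e F) p)) (F⊆S (fst∈vertices e∈F)) |S|≤V w))

  isTreeᵇ⇐ : SpansFrom → T (isTreeᵇ V (x ∷ S) F)
  isTreeᵇ⇐ (F⊆S , reaches , acyclic) =
    ∧-intro ends (∧-intro reach acyc)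
    where
    ends : T (endpointsInᵇ (x ∷ S) F)
    ends = ∀⇒all _ F (λ e∈F → ∧-intro (∈⇒∈ᵇ (F⊆S (fst∈vertices e∈F))) (∈⇒∈ᵇ (F⊆S (snd∈vertices e∈F))))
    reach : T (reachesAllᵇ V F x (x ∷ S))
    reach = ∀⇒all (connectedᵇ V F x) (x ∷ S)
      (λ p → ∈⇒∈ᵇ (Saturation.reachWithin-saturated F x (x ∷ S) F⊆S (here refl) |S|≤V (reaches p)))
    acyc : T (acyclicᵇ V F)
    acyc = ∀⇒all _ F (λ {e} e∈F → ¬T⇒T-not (λ t → acyclic e∈F
      (reachWithin-sound V (removeEdge e F) (proj₁ e) (∈ᵇ⇒∈ (reachWithin V (removeEdge e F) (proj₁ e)) t))))

SameSet : List ℕ → List ℕ → Set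
SameSet S W = S ⊆ W × W ⊆ S

sameSetᵇ : List ℕ → List ℕ → Bool
sameSetᵇ S W = all (_∈ᵇ W) S ∧ all (_∈ᵇ S) W

sameSetᵇ⇒ : ∀ S W → T (sameSetᵇ S W) → SameSet S W
sameSetᵇ⇒ S W t =
    (λ p → ∈ᵇ⇒∈ W (all⇒∀ (_∈ᵇ W) (∧-elimˡ {all (_∈ᵇ W) S} t) p))
  , (λ p → ∈ᵇ⇒∈ S (all⇒∀ (_∈ᵇ S) (∧-elimʳ {all (_∈ᵇ W) S} t) p))

sameSetᵇ⇐ : ∀ S W → SameSet S W → T (sameSetᵇ S W)
sameSetᵇ⇐ S W (S⊆W , W⊆S) = ∧-intro (∀⇒all (_∈ᵇ W) S (∈⇒∈ᵇ ∘ S⊆W)) (∀⇒all (_∈ᵇ S) W (∈⇒∈ᵇ ∘ W⊆S))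

module _ (V : ℕ) {F : List (ℕ × ℕ)} {e₀} (e₀∈F : e₀ ∈ F) where

  isTreeᵇ⇒IsTree : ∀ S → length S ≤ V → T (isTreeᵇ V S F) → IsTree F × SameSet S (vertices F)
  isTreeᵇ⇒IsTree (x ∷ S) |S|≤V t with isTreeᵇ⇒ V x S F |S|≤V t
  ... | F⊆S , reaches , acyclic = (connected , acyclic) , S⊆F , F⊆S
    where
    x∈F : x ∈ vertices F
    x∈F with Walk-end (reverseʷ (reaches (F⊆S (fst∈vertices e₀∈F))))
    ... | inj₁ refl = fst∈vertices e₀∈F
    ... | inj₂ p    = p
    S⊆F : x ∷ S ⊆ vertices F
    S⊆F p with Walk-end (reaches p)
    ... | inj₁ refl = x∈F
    ... | inj₂ q    = q
    connected : Connected F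
    connected pu pv = reverseʷ (reaches (F⊆S pu)) ++ʷ reaches (F⊆S pv)

  IsTree⇒isTreeᵇ : ∀ S → length S ≤ V → IsTree F × SameSet S (vertices F) → T (isTreeᵇ V S F)
  IsTree⇒isTreeᵇ [] _ (_ , _ , F⊆S) with F⊆S (fst∈vertices e₀∈F)
  ... | ()
  IsTree⇒isTreeᵇ (x ∷ S) |S|≤V ((connected , acyclic) , S⊆F , F⊆S) =
    isTreeᵇ⇐ V x S F |S|≤V (F⊆S , (λ p → connected (S⊆F (here refl)) (S⊆F p)) , acyclic)

treeᵇ : List (ℕ × ℕ) → Bool
treeᵇ F = isTreeᵇ (length (vertices F)) (vertices F) F

module _ {F : List (ℕ × ℕ)} {e₀} (e₀∈F : e₀ ∈ F) where

  treeᵇ⇒IsTree : T (treeᵇ F) → IsTree F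
  treeᵇ⇒IsTree = proj₁ ∘ isTreeᵇ⇒IsTree _ e₀∈F (vertices F) ℕ.≤-refl

  IsTree⇒treeᵇ : IsTree F → T (treeᵇ F)
  IsTree⇒treeᵇ tree = IsTree⇒isTreeᵇ _ e₀∈F (vertices F) ℕ.≤-refl (tree , (λ p → p) , (λ p → p))

  isTreeᵇ-≡ : ∀ V S → length S ≤ V → isTreeᵇ V S F ≡ treeᵇ F ∧ sameSetᵇ S (vertices F)
  isTreeᵇ-≡ V S |S|≤V = T-injective
    (λ t → let tree , same = isTreeᵇ⇒IsTree V e₀∈F S |S|≤V t in
           ∧-intro (IsTree⇒treeᵇ tree) (sameSetᵇ⇐ S (vertices F) same))
    (λ t → IsTree⇒isTreeᵇ V e₀∈F S |S|≤V
             (treeᵇ⇒IsTree (∧-elimˡ {treeᵇ F} t) , sameSetᵇ⇒ S (vertices F) (∧-elimʳ {treeᵇ F} t)))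

isSingletonᵇ : List ℕ → Bool
isSingletonᵇ []      = false
isSingletonᵇ (x ∷ S) = all (_≡ᵇ x) S

isTreeᵇ-[] : ∀ V S → length S ≤ V → isTreeᵇ V S [] ≡ isSingletonᵇ S
isTreeᵇ-[] V []      _     = refl
isTreeᵇ-[] V (x ∷ S) |S|≤V = T-injective
  (λ t → ∀⇒all (_≡ᵇ x) S (λ p → ℕ.≡⇒≡ᵇ _ x (trivial (proj₁ (proj₂ (isTreeᵇ⇒ V x S [] |S|≤V t)) (there p)))))
  (λ t → isTreeᵇ⇐ V x S [] |S|≤V ((λ ()) , (λ p → walk t p) , (λ ())))
  where
  trivial : ∀ {z} → Walk [] x z → z ≡ x
  trivial ε = refl
  trivial (_ ▷ inj₁ ())
  trivial (_ ▷ inj₂ ())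
  walk : T (all (_≡ᵇ x) S) → ∀ {z} → z ∈ x ∷ S → Walk [] x z
  walk t (here refl) = ε
  walk t {z} (there p) with ℕ.≡ᵇ⇒≡ z x (all⇒∀ (_≡ᵇ x) t p)
  ... | refl = ε

without : ℕ → List ℕ → List ℕ
without x = filter (λ w → ¬? (w ℕ.≟ x))

sameSetᵇ-∉ʳ : ∀ {S W x} → x ∈ S → ¬ x ∈ W → sameSetᵇ S W ≡ false
sameSetᵇ-∉ʳ {S} {W} x∈S x∉W = T-false (λ t → x∉W (proj₁ (sameSetᵇ⇒ S W t) x∈S))

sameSetᵇ-∉ˡ : ∀ {S W x} → ¬ x ∈ S → x ∈ W → sameSetᵇ S W ≡ false
sameSetᵇ-∉ˡ {S} {W} x∉S x∈W = T-false (λ t → x∉S (proj₂ (sameSetᵇ⇒ S W t) x∈W))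

sameSetᵇ-∷ : ∀ {x Q W} → ¬ x ∈ Q → x ∈ W → sameSetᵇ (x ∷ Q) W ≡ sameSetᵇ Q (without x W)
sameSetᵇ-∷ {x} {Q} {W} x∉Q x∈W = T-injective
  (λ t → let xQ⊆W , W⊆xQ = sameSetᵇ⇒ (x ∷ Q) W t in sameSetᵇ⇐ Q (without x W)
    ( (λ {z} z∈Q → ∈-filter⁺ (λ w → ¬? (w ℕ.≟ x)) (xQ⊆W (there z∈Q)) (λ { refl → x∉Q z∈Q }))
    , (λ z∈W∖x → let z∈W , z≢x = ∈-filter⁻ (λ w → ¬? (w ℕ.≟ x)) z∈W∖x in
                 dropHead z≢x (W⊆xQ z∈W))))
  (λ t → let Q⊆W∖x , W∖x⊆Q = sameSetᵇ⇒ Q (without x W) t in sameSetᵇ⇐ (x ∷ Q) W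
    ( (λ { (here refl) → x∈W ; (there z∈Q) → proj₁ (∈-filter⁻ (λ w → ¬? (w ℕ.≟ x)) (Q⊆W∖x z∈Q)) })
    , restore W∖x⊆Q))
  where
  dropHead : ∀ {z} → z ≢ x → z ∈ x ∷ Q → z ∈ Q
  dropHead z≢x (here z≡x) = ⊥-elim (z≢x z≡x)
  dropHead z≢x (there z∈Q) = z∈Q
  restore : without x W ⊆ Q → W ⊆ x ∷ Q
  restore W∖x⊆Q {z} z∈W with z ℕ.≟ x
  ... | yes refl = here refl
  ... | no z≢x   = there (W∖x⊆Q (∈-filter⁺ (λ w → ¬? (w ℕ.≟ x)) z∈W z≢x))

∑-subsets-sameSet : ∀ L → Unique L → ∀ W → W ⊆ L →
                    (∑[ S ∈ subsets L ] 𝟙 (sameSetᵇ S W)) ≡ 1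
∑-subsets-sameSet [] _ [] _ = refl
∑-subsets-sameSet [] _ (w ∷ W) W⊆[] with W⊆[] (here refl)
... | ()
∑-subsets-sameSet (x ∷ L) unique W W⊆xL
  rewrite ∑-++ (subsets L) (map (x ∷_) (subsets L)) (λ S → 𝟙 (sameSetᵇ S W))
  | ∑-map (x ∷_) (subsets L) (λ S → 𝟙 (sameSetᵇ S W)) with x ∈? W
... | yes x∈W = begin
    (∑[ S ∈ subsets L ] 𝟙 (sameSetᵇ S W)) + (∑[ Q ∈ subsets L ] 𝟙 (sameSetᵇ (x ∷ Q) W))
      ≡⟨ cong₂ _+_ (∑-zero (subsets L) (λ S∈ → cong 𝟙 (sameSetᵇ-∉ˡ (x∉ S∈) x∈W)))
                   (∑-cong (subsets L) (λ Q∈ → cong 𝟙 (sameSetᵇ-∷ (x∉ Q∈) x∈W))) ⟩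
    (∑[ Q ∈ subsets L ] 𝟙 (sameSetᵇ Q (without x W)))
      ≡⟨ ∑-subsets-sameSet L (tail unique) (without x W) W∖x⊆L ⟩
    1 ∎
  where
  x∉ : ∀ {S} → S ∈ subsets L → ¬ x ∈ S
  x∉ S∈ x∈S = Unique⇒∉ unique (subsets-⊆ L S∈ x∈S)
  W∖x⊆L : without x W ⊆ L
  W∖x⊆L z∈ with ∈-filter⁻ (λ w → ¬? (w ℕ.≟ x)) z∈
  ... | z∈W , z≢x with W⊆xL z∈W
  ...   | here z≡x = ⊥-elim (z≢x z≡x)
  ...   | there z∈L = z∈L
... | no x∉W = begin
    (∑[ S ∈ subsets L ] 𝟙 (sameSetᵇ S W)) + (∑[ Q ∈ subsets L ] 𝟙 (sameSetᵇ (x ∷ Q) W))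
      ≡⟨ cong₂ _+_ (∑-subsets-sameSet L (tail unique) W W⊆L)
                   (∑-zero (subsets L) (λ {Q} _ → cong 𝟙 (sameSetᵇ-∉ʳ {x ∷ Q} (here refl) x∉W))) ⟩
    1 ∎
  where
  W⊆L : W ⊆ L
  W⊆L z∈W with W⊆xL z∈W
  ... | here refl = ⊥-elim (x∉W z∈W)
  ... | there z∈L = z∈L

∑-subsets-singleton : ∀ L → Unique L → (∑[ S ∈ subsets L ] 𝟙 (isSingletonᵇ S)) ≡ length L
∑-subsets-singleton []      _ = refl
∑-subsets-singleton (x ∷ L) unique
  rewrite ∑-++ (subsets L) (map (x ∷_) (subsets L)) (𝟙 ∘ isSingletonᵇ)
  | ∑-map (x ∷_) (subsets L) (𝟙 ∘ isSingletonᵇ) | ∑-subsets-singleton L (tail unique)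
  = trans (cong (length L +_) (trans (∑-cong (subsets L) onlyEmpty) (∑-subsets-null L))) (ℕ.+-comm (length L) 1)
  where
  onlyEmpty : ∀ {Q} → Q ∈ subsets L → 𝟙 (isSingletonᵇ (x ∷ Q)) ≡ 𝟙 (null Q)
  onlyEmpty {[]}    _  = refl
  onlyEmpty {t ∷ Q} Q∈ = cong 𝟙 (T-false (λ s → Unique⇒∉ unique
    (subst (_∈ L) (ℕ.≡ᵇ⇒≡ t x (∧-elimˡ {t ≡ᵇ x} s)) (subsets-⊆ L Q∈ (here refl)))))

edgeTrees : List (ℕ × ℕ) → ℕ
edgeTrees E = ∑[ F ∈ subsets E ] 𝟙 (treeᵇ F)

module _ (V : ℕ) where

  private
    SS : List (List ℕ)
    SS = subsets (upTo V)

    length-SS : ∀ {S} → S ∈ SS → length S ≤ V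
    length-SS {S} S∈ = subst (length S ≤_) (List.length-upTo V) (length-subsets (upTo V) S∈)

  spanningTrees-[] : (∑[ S ∈ SS ] 𝟙 (isTreeᵇ V S [])) ≡ V
  spanningTrees-[] = begin
    (∑[ S ∈ SS ] 𝟙 (isTreeᵇ V S []))  ≡⟨ ∑-cong SS (λ {S} S∈ → cong 𝟙 (isTreeᵇ-[] V S (length-SS S∈))) ⟩
    (∑[ S ∈ SS ] 𝟙 (isSingletonᵇ S)) ≡⟨ ∑-subsets-singleton (upTo V) (upTo⁺ V) ⟩
    length (upTo V)                  ≡⟨ List.length-upTo V ⟩
    V                                ∎

  spanningTrees-∷ : ∀ e F → vertices (e ∷ F) ⊆ upTo V → (∑[ S ∈ SS ] 𝟙 (isTreeᵇ V S (e ∷ F))) ≡ 𝟙 (treeᵇ (e ∷ F))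
  spanningTrees-∷ e F F⊆V = begin
    (∑[ S ∈ SS ] 𝟙 (isTreeᵇ V S (e ∷ F)))
      ≡⟨ ∑-cong SS (λ {S} S∈ → trans (cong 𝟙 (isTreeᵇ-≡ {e ∷ F} (here refl) V S (length-SS S∈))) (𝟙-∧ (treeᵇ (e ∷ F)) _)) ⟩
    (∑[ S ∈ SS ] 𝟙 (treeᵇ (e ∷ F)) * 𝟙 (sameSetᵇ S (vertices (e ∷ F))))
      ≡⟨ ∑-*ˡ SS (𝟙 (treeᵇ (e ∷ F))) _ ⟩
    𝟙 (treeᵇ (e ∷ F)) * (∑[ S ∈ SS ] 𝟙 (sameSetᵇ S (vertices (e ∷ F))))
      ≡⟨ cong (𝟙 (treeᵇ (e ∷ F)) *_) (∑-subsets-sameSet (upTo V) (upTo⁺ V) (vertices (e ∷ F)) F⊆V) ⟩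
    𝟙 (treeᵇ (e ∷ F)) * 1
      ≡⟨ ℕ.*-identityʳ _ ⟩
    𝟙 (treeᵇ (e ∷ F)) ∎

STN-edgeTrees : ∀ G → vertices (E G) ⊆ upTo (V G) → STN G ≡ V G + edgeTrees (E G)
STN-edgeTrees G E⊆V = begin
  STN G
    ≡⟨ length-filter (λ p → isTreeᵇ (V G) (proj₁ p) (proj₂ p)) (subgraphs G) ⟩
  (∑[ p ∈ subgraphs G ] 𝟙 (isTreeᵇ (V G) (proj₁ p) (proj₂ p)))
    ≡⟨ ∑-pairs SS FS (λ p → 𝟙 (isTreeᵇ (V G) (proj₁ p) (proj₂ p))) ⟩
  (∑[ S ∈ SS ] ∑[ F ∈ FS ] 𝟙 (isTreeᵇ (V G) S F))
    ≡⟨ ∑-comm SS FS (λ S F → 𝟙 (isTreeᵇ (V G) S F)) ⟩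
  (∑[ F ∈ FS ] ∑[ S ∈ SS ] 𝟙 (isTreeᵇ (V G) S F))
    ≡⟨ ∑-cong FS spanningTrees ⟩
  (∑[ F ∈ FS ] (𝟙 (null F) * V G + 𝟙 (treeᵇ F)))
    ≡⟨ ∑-+ FS (λ F → 𝟙 (null F) * V G) (𝟙 ∘ treeᵇ) ⟩
  (∑[ F ∈ FS ] 𝟙 (null F) * V G) + edgeTrees (E G)
    ≡⟨ cong (_+ edgeTrees (E G)) (trans (∑-*ʳ FS (V G) (𝟙 ∘ null)) (cong (_* V G) (∑-subsets-null (E G)))) ⟩
  1 * V G + edgeTrees (E G)
    ≡⟨ cong (_+ edgeTrees (E G)) (ℕ.*-identityˡ (V G)) ⟩
  V G + edgeTrees (E G) ∎
  where
  SS : List (List ℕ)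
  SS = subsets (upTo (V G))
  FS : List (List (ℕ × ℕ))
  FS = subsets (E G)
  spanningTrees : ∀ {F} → F ∈ FS → (∑[ S ∈ SS ] 𝟙 (isTreeᵇ (V G) S F)) ≡ 𝟙 (null F) * V G + 𝟙 (treeᵇ F)
  spanningTrees {[]}    _  = trans (spanningTrees-[] (V G)) (sym (trans (ℕ.+-identityʳ _) (ℕ.*-identityˡ (V G))))
  spanningTrees {e ∷ F} F∈ = spanningTrees-∷ (V G) e F (E⊆V ∘ vertices-mono (subsets-⊆ (E G) F∈))

MeetOnlyAt : List (ℕ × ℕ) → List (ℕ × ℕ) → ℕ → Set
MeetOnlyAt A B c = ∀ {z} → z ∈ vertices A → z ∈ vertices B → z ≡ c

MeetOnlyAt-sym : ∀ {A B c} → MeetOnlyAt A B c → MeetOnlyAt B A c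
MeetOnlyAt-sym meet zB zA = meet zA zB

MeetOnlyAt-removeEdge : ∀ {A B c} e f → MeetOnlyAt A B c → MeetOnlyAt (removeEdge e A) (removeEdge f B) c
MeetOnlyAt-removeEdge {A} {B} e f meet zA zB =
  meet (vertices-mono (removeEdge-⊆ e A) zA) (vertices-mono (removeEdge-⊆ f B) zB)

SplitWalk : List (ℕ × ℕ) → List (ℕ × ℕ) → ℕ → ℕ → ℕ → Set
SplitWalk A B c u v =
  Walk A u v ⊎ Walk B u v ⊎ ((Walk A u c ⊎ Walk B u c) × (Walk A c v ⊎ Walk B c v))

SplitWalk-swap : ∀ {A B c u v} → SplitWalk A B c u v → SplitWalk B A c u v
SplitWalk-swap (inj₁ w)               = inj₂ (inj₁ w)
SplitWalk-swap (inj₂ (inj₁ w))        = inj₁ w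
SplitWalk-swap (inj₂ (inj₂ (w , w′))) = inj₂ (inj₂ (swap w , swap w′))

SplitWalk-▷ : ∀ {A B c u v w} → MeetOnlyAt A B c → SplitWalk A B c u v → Adj A v w → SplitWalk A B c u w
SplitWalk-▷ meet (inj₁ p) a = inj₁ (p ▷ a)
SplitWalk-▷ meet (inj₂ (inj₁ p)) a with Walk-end p
... | inj₁ refl = inj₁ (ε ▷ a)
... | inj₂ v∈B with meet (proj₁ (Adj-vertices a)) v∈B
...   | refl = inj₂ (inj₂ (inj₂ p , inj₁ (ε ▷ a)))
SplitWalk-▷ meet (inj₂ (inj₂ (p , inj₁ q))) a = inj₂ (inj₂ (p , inj₁ (q ▷ a)))
SplitWalk-▷ meet (inj₂ (inj₂ (p , inj₂ q))) a with Walk-end q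
... | inj₁ refl = inj₂ (inj₂ (p , inj₁ (ε ▷ a)))
... | inj₂ v∈B with meet (proj₁ (Adj-vertices a)) v∈B
...   | refl = inj₂ (inj₂ (p , inj₁ (ε ▷ a)))

splitWalk : ∀ {A B c u v} → MeetOnlyAt A B c → Walk (A ++ B) u v → SplitWalk A B c u v
splitWalk meet ε = inj₁ ε
splitWalk {A} {B} meet (w ▷ a) with Adj-++ {A} {B} a
... | inj₁ aA = SplitWalk-▷ meet (splitWalk meet w) aA
... | inj₂ aB = SplitWalk-swap (SplitWalk-▷ (MeetOnlyAt-sym meet) (SplitWalk-swap (splitWalk meet w)) aB)

SplitWalk-restrict : ∀ {A B c u v} → (u ∈ vertices B → u ≡ c) → (v ∈ vertices B → v ≡ c) →
                     SplitWalk A B c u v → Walk A u v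
SplitWalk-restrict u∉B v∉B (inj₁ p) = p
SplitWalk-restrict u∉B v∉B (inj₂ (inj₁ p)) with Walk-ends p
... | inj₁ refl = ε
... | inj₂ (u∈B , v∈B) with u∉B u∈B | v∉B v∈B
...   | refl | refl = ε
SplitWalk-restrict {A} {B} {c} {u} {v} u∉B v∉B (inj₂ (inj₂ (p , q))) = toCut p ++ʷ fromCut q
  where
  toCut : Walk A u c ⊎ Walk B u c → Walk A u c
  toCut (inj₁ r) = r
  toCut (inj₂ r) with Walk-ends r
  ... | inj₁ refl = ε
  ... | inj₂ (u∈B , _) with u∉B u∈B
  ...   | refl = ε
  fromCut : Walk A c v ⊎ Walk B c v → Walk A c v
  fromCut (inj₁ r) = r
  fromCut (inj₂ r) with Walk-ends r
  ... | inj₁ refl = ε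
  ... | inj₂ (_ , v∈B) with v∉B v∈B
  ...   | refl = ε

LoopFree : List (ℕ × ℕ) → Set
LoopFree F = ∀ {p q} → (p , q) ∈ F → p ≢ q

LoopFree-⊆ : ∀ {A B} → A ⊆ B → LoopFree B → LoopFree A
LoopFree-⊆ A⊆B loopFree = loopFree ∘ A⊆B

vertex-≢ : ∀ {F e} → LoopFree F → e ∈ F → ∀ c → ∃ λ u → u ∈ vertices F × u ≢ c
vertex-≢ {e = p , q} loopFree e∈F c with p ℕ.≟ c
... | yes refl = q , snd∈vertices e∈F , loopFree e∈F ∘ sym
... | no p≢c   = p , fst∈vertices e∈F , p≢c

nontrivial-walk : ∀ {F u v} → Walk F u v → u ≢ v → u ∈ vertices F × v ∈ vertices F
nontrivial-walk w u≢v with Walk-ends w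
... | inj₁ u≡v = ⊥-elim (u≢v u≡v)
... | inj₂ ends = ends

treeThroughᵇ : ℕ → List (ℕ × ℕ) → Bool
treeThroughᵇ c F = treeᵇ F ∧ (c ∈ᵇ vertices F)

module _ {A B : List (ℕ × ℕ)} {c : ℕ} (meet : MeetOnlyAt A B c) where

  private
    ⊆-++ˡ : vertices A ⊆ vertices (A ++ B)
    ⊆-++ˡ = vertices-mono ∈-++⁺ˡ
    ⊆-++ʳ : vertices B ⊆ vertices (A ++ B)
    ⊆-++ʳ = vertices-mono (∈-++⁺ʳ A)

  cut-in-both : ∀ {u v} → u ∈ vertices A → u ≢ c → v ∈ vertices B → v ≢ c →
                SplitWalk A B c u v → c ∈ vertices A × c ∈ vertices B
  cut-in-both uA u≢c vB v≢c (inj₁ p) with Walk-ends p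
  ... | inj₁ refl     = ⊥-elim (u≢c (meet uA vB))
  ... | inj₂ (_ , vA) = ⊥-elim (v≢c (meet vA vB))
  cut-in-both uA u≢c vB v≢c (inj₂ (inj₁ p)) with Walk-ends p
  ... | inj₁ refl     = ⊥-elim (u≢c (meet uA vB))
  ... | inj₂ (uB , _) = ⊥-elim (u≢c (meet uA uB))
  cut-in-both {u} {v} uA u≢c vB v≢c (inj₂ (inj₂ (p , q))) = cA p , cB q
    where
    cA : Walk A u c ⊎ Walk B u c → c ∈ vertices A
    cA (inj₁ r) = proj₂ (nontrivial-walk r u≢c)
    cA (inj₂ r) = ⊥-elim (u≢c (meet uA (proj₁ (nontrivial-walk r u≢c))))
    cB : Walk A c v ⊎ Walk B c v → c ∈ vertices B
    cB (inj₁ r) = ⊥-elim (v≢c (meet (proj₂ (nontrivial-walk r (v≢c ∘ sym))) vB))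
    cB (inj₂ r) = proj₁ (nontrivial-walk r (v≢c ∘ sym))

  IsTree-++⁻ : ∀ {eA eB} → LoopFree A → LoopFree B → eA ∈ A → eB ∈ B → IsTree (A ++ B) →
               (IsTree A × c ∈ vertices A) × (IsTree B × c ∈ vertices B)
  IsTree-++⁻ loopFreeA loopFreeB eA∈A eB∈B (connected , acyclic) =
    ((connectedA , acyclicA) , proj₁ cut) , ((connectedB , acyclicB) , proj₂ cut)
    where
    connectedA : Connected A
    connectedA pu pv = SplitWalk-restrict (meet pu) (meet pv) (splitWalk meet (connected (⊆-++ˡ pu) (⊆-++ˡ pv)))
    connectedB : Connected B
    connectedB pu pv = SplitWalk-restrict (λ q → meet q pu) (λ q → meet q pv)
                         (SplitWalk-swap (splitWalk meet (connected (⊆-++ʳ pu) (⊆-++ʳ pv))))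
    lift : ∀ {e u v} → Walk (removeEdge e A ++ removeEdge e B) u v → Walk (removeEdge e (A ++ B)) u v
    lift {e} = subst (λ F → Walk F _ _) (sym (removeEdge-++ e A B))
    acyclicA : Acyclic A
    acyclicA e∈A w = acyclic (∈-++⁺ˡ e∈A) (lift (Walk-mono ∈-++⁺ˡ w))
    acyclicB : Acyclic B
    acyclicB {e} e∈B w = acyclic (∈-++⁺ʳ A e∈B) (lift (Walk-mono (∈-++⁺ʳ (removeEdge e A)) w))
    cut : c ∈ vertices A × c ∈ vertices B
    cut = let u , uA , u≢c = vertex-≢ loopFreeA eA∈A c
              v , vB , v≢c = vertex-≢ loopFreeB eB∈B c
          in cut-in-both uA u≢c vB v≢c (splitWalk meet (connected (⊆-++ˡ uA) (⊆-++ʳ vB)))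

  IsTree-++⁺ : IsTree A × c ∈ vertices A → IsTree B × c ∈ vertices B → IsTree (A ++ B)
  IsTree-++⁺ ((connectedA , acyclicA) , cA) ((connectedB , acyclicB) , cB) = connected , acyclic
    where
    toCut : ∀ {z} → z ∈ vertices (A ++ B) → Walk (A ++ B) z c
    toCut {z} p with ∈-++⁻ (vertices A) (subst (z ∈_) (vertices-++ A B) p)
    ... | inj₁ q = Walk-mono ∈-++⁺ˡ (connectedA q cA)
    ... | inj₂ q = Walk-mono (∈-++⁺ʳ A) (connectedB q cB)
    connected : Connected (A ++ B)
    connected pu pv = toCut pu ++ʷ reverseʷ (toCut pv)
    split : ∀ {e u v} → Walk (removeEdge e (A ++ B)) u v → SplitWalk (removeEdge e A) (removeEdge e B) c u v
    split {e} w = splitWalk (MeetOnlyAt-removeEdge e e meet) (subst (λ F → Walk F _ _) (removeEdge-++ e A B) w)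
    acyclic : Acyclic (A ++ B)
    acyclic {e} e∈A++B w with ∈-++⁻ A e∈A++B
    ... | inj₁ e∈A = acyclicA e∈A (SplitWalk-restrict
            (λ q → meet (fst∈vertices e∈A) (vertices-mono (removeEdge-⊆ e B) q))
            (λ q → meet (snd∈vertices e∈A) (vertices-mono (removeEdge-⊆ e B) q))
            (split w))
    ... | inj₂ e∈B = acyclicB e∈B (SplitWalk-restrict
            (λ q → meet (vertices-mono (removeEdge-⊆ e A) q) (fst∈vertices e∈B))
            (λ q → meet (vertices-mono (removeEdge-⊆ e A) q) (snd∈vertices e∈B))
            (SplitWalk-swap (split w)))

  treeᵇ-++ : ∀ {eA eB} → LoopFree A → LoopFree B → eA ∈ A → eB ∈ B →
             treeᵇ (A ++ B) ≡ treeThroughᵇ c A ∧ treeThroughᵇ c B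
  treeᵇ-++ loopFreeA loopFreeB eA∈A eB∈B = T-injective
    (λ t → let (treeA , cA) , (treeB , cB) = IsTree-++⁻ loopFreeA loopFreeB eA∈A eB∈B (treeᵇ⇒IsTree (∈-++⁺ˡ eA∈A) t)
           in ∧-intro (∧-intro (IsTree⇒treeᵇ eA∈A treeA) (∈⇒∈ᵇ cA)) (∧-intro (IsTree⇒treeᵇ eB∈B treeB) (∈⇒∈ᵇ cB)))
    (λ t → let tA = ∧-elimˡ {treeThroughᵇ c A} t
               tB = ∧-elimʳ {treeThroughᵇ c A} t
           in IsTree⇒treeᵇ (∈-++⁺ˡ eA∈A) (IsTree-++⁺
                (treeᵇ⇒IsTree eA∈A (∧-elimˡ {treeᵇ A} tA) , ∈ᵇ⇒∈ (vertices A) (∧-elimʳ {treeᵇ A} tA))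
                (treeᵇ⇒IsTree eB∈B (∧-elimˡ {treeᵇ B} tB) , ∈ᵇ⇒∈ (vertices B) (∧-elimʳ {treeᵇ B} tB))))

edgeTreesThrough : ℕ → List (ℕ × ℕ) → ℕ
edgeTreesThrough c E = ∑[ F ∈ subsets E ] 𝟙 (treeThroughᵇ c F)

module Relabel (f : ℕ → ℕ) (f-injective : ∀ {x y} → f x ≡ f y → x ≡ y) where

  relabel : ℕ × ℕ → ℕ × ℕ
  relabel (u , v) = f u , f v

  ≡ᵇ-relabel : ∀ x y → (f x ≡ᵇ f y) ≡ (x ≡ᵇ y)
  ≡ᵇ-relabel x y = T-injective (ℕ.≡⇒≡ᵇ x y ∘ f-injective ∘ ℕ.≡ᵇ⇒≡ (f x) (f y))
                               (ℕ.≡⇒≡ᵇ (f x) (f y) ∘ cong f ∘ ℕ.≡ᵇ⇒≡ x y)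

  ∈ᵇ-map : ∀ x R → (f x ∈ᵇ map f R) ≡ (x ∈ᵇ R)
  ∈ᵇ-map x []      = refl
  ∈ᵇ-map x (y ∷ R) = cong₂ _∨_ (≡ᵇ-relabel x y) (∈ᵇ-map x R)

  vertices-map : ∀ F → vertices (map relabel F) ≡ map f (vertices F)
  vertices-map []            = refl
  vertices-map ((u , v) ∷ F) = cong (λ t → f u ∷ f v ∷ t) (vertices-map F)

  removeEdge-map : ∀ e F → removeEdge (relabel e) (map relabel F) ≡ map relabel (removeEdge e F)
  removeEdge-map e [] = refl
  removeEdge-map (a , b) ((c , d) ∷ F)
    rewrite ≡ᵇ-relabel a c | ≡ᵇ-relabel b d with (a , b) ≡ᴱ (c , d)
  ... | true  = removeEdge-map (a , b) F
  ... | false = cong ((f c , f d) ∷_) (removeEdge-map (a , b) F)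

  if-map : ∀ b (y : ℕ) → (if b then f y ∷ [] else []) ≡ map f (if b then y ∷ [] else [])
  if-map true  y = refl
  if-map false y = refl

  edgeNeighbours-map : ∀ R e → edgeNeighbours (map f R) (relabel e) ≡ map f (edgeNeighbours R e)
  edgeNeighbours-map R (u , v) rewrite ∈ᵇ-map u R | ∈ᵇ-map v R =
    trans (cong₂ _++_ (if-map (u ∈ᵇ R) v) (if-map (v ∈ᵇ R) u)) (sym (List.map-++ f (if u ∈ᵇ R then v ∷ [] else []) _))

  step-map : ∀ F R → step (map relabel F) (map f R) ≡ map f (step F R)
  step-map F R = begin
    map f R ++ concatMap (edgeNeighbours (map f R)) (map relabel F)
      ≡⟨ cong (map f R ++_) (List.concatMap-map (edgeNeighbours (map f R)) relabel F) ⟩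
    map f R ++ concatMap (edgeNeighbours (map f R) ∘ relabel) F
      ≡⟨ cong (map f R ++_) (List.concatMap-cong (edgeNeighbours-map R) F) ⟩
    map f R ++ concatMap (map f ∘ edgeNeighbours R) F
      ≡⟨ cong (map f R ++_) (List.map-concatMap f (edgeNeighbours R) F) ⟨
    map f R ++ map f (neighbours F R)
      ≡⟨ List.map-++ f R (neighbours F R) ⟨
    map f (step F R) ∎


  reachWithin-map : ∀ k F x → reachWithin k (map relabel F) (f x) ≡ map f (reachWithin k F x)
  reachWithin-map zero    F x = refl
  reachWithin-map (suc k) F x rewrite reachWithin-map k F x = step-map F (reachWithin k F x)

  connectedᵇ-map : ∀ V F x y → connectedᵇ V (map relabel F) (f x) (f y) ≡ connectedᵇ V F x y
  connectedᵇ-map V F x y rewrite reachWithin-map V F x = ∈ᵇ-map y (reachWithin V F x)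

  isTreeᵇ-map : ∀ V S F → isTreeᵇ V (map f S) (map relabel F) ≡ isTreeᵇ V S F
  isTreeᵇ-map V []      F = refl
  isTreeᵇ-map V (x ∷ S) F = cong₂ _∧_ ends (cong₂ _∧_ reach acyc)
    where
    ends : endpointsInᵇ (f x ∷ map f S) (map relabel F) ≡ endpointsInᵇ (x ∷ S) F
    ends = trans (all-map _ relabel F)
                 (all-cong (λ { (a , b) → cong₂ _∧_ (∈ᵇ-map a (x ∷ S)) (∈ᵇ-map b (x ∷ S)) }) F)
    reach : reachesAllᵇ V (map relabel F) (f x) (f x ∷ map f S) ≡ reachesAllᵇ V F x (x ∷ S)
    reach = trans (all-map _ f (x ∷ S)) (all-cong (connectedᵇ-map V F x) (x ∷ S))
    acyc : acyclicᵇ V (map relabel F) ≡ acyclicᵇ V F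
    acyc = trans (all-map _ relabel F) (all-cong (λ { (a , b) → cong not (trans
             (cong (λ G → connectedᵇ V G (f a) (f b)) (removeEdge-map (a , b) F))
             (connectedᵇ-map V (removeEdge (a , b) F) a b)) }) F)

  treeᵇ-map : ∀ F → treeᵇ (map relabel F) ≡ treeᵇ F
  treeᵇ-map F rewrite vertices-map F | List.length-map f (vertices F) = isTreeᵇ-map _ (vertices F) F

  treeThroughᵇ-map : ∀ c F → treeThroughᵇ (f c) (map relabel F) ≡ treeThroughᵇ c F
  treeThroughᵇ-map c F = cong₂ _∧_ (treeᵇ-map F) (trans (cong (f c ∈ᵇ_) (vertices-map F)) (∈ᵇ-map c (vertices F)))

-- The middle clause makes `map relabel hexagon₀` reduce to `hexEdges a b`, which writes b rather than b + 0.
hexagonLabel : ℕ → ℕ → ℕ → ℕ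
hexagonLabel a b zero          = a
hexagonLabel a b (suc zero)    = b
hexagonLabel a b (suc (suc i)) = b + suc i

hexagonLabel-suc : ∀ a b i → hexagonLabel a b (suc i) ≡ b + i
hexagonLabel-suc a b zero    = sym (ℕ.+-identityʳ b)
hexagonLabel-suc a b (suc i) = refl

module _ {a b : ℕ} (a<b : a < b) where

  hexagonLabel-injective : ∀ {x y} → hexagonLabel a b x ≡ hexagonLabel a b y → x ≡ y
  hexagonLabel-injective {zero}  {zero}  _  = refl
  hexagonLabel-injective {zero}  {suc y} eq =
    ⊥-elim (ℕ.<⇒≢ (ℕ.<-≤-trans a<b (ℕ.m≤m+n b y)) (trans eq (hexagonLabel-suc a b y)))
  hexagonLabel-injective {suc x} {zero}  eq =
    ⊥-elim (ℕ.<⇒≢ (ℕ.<-≤-trans a<b (ℕ.m≤m+n b x)) (trans (sym eq) (hexagonLabel-suc a b x)))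
  hexagonLabel-injective {suc x} {suc y} eq = cong suc (ℕ.+-cancelˡ-≡ b x y
    (trans (sym (hexagonLabel-suc a b x)) (trans eq (hexagonLabel-suc a b y))))

  hexagonLabel-≤ : ∀ {i} → i ≤ 5 → hexagonLabel a b i ≤ b + 4
  hexagonLabel-≤ {zero}  _   = ℕ.≤-trans (ℕ.<⇒≤ a<b) (ℕ.m≤m+n b 4)
  hexagonLabel-≤ {suc i} i≤5 rewrite hexagonLabel-suc a b i = ℕ.+-monoʳ-≤ b (s≤s⁻¹ i≤5)

hexagon₀ : List (ℕ × ℕ)
hexagon₀ = hexEdges 0 1

hexagon₀-vertices-≤ : ∀ {i} → i ∈ vertices hexagon₀ → i ≤ 5
hexagon₀-vertices-≤ {i} p = ℕ.≤ᵇ⇒≤ i 5 (all⇒∀ (_≤ᵇ 5) {vertices hexagon₀} _ p)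

hexagon₀-loopFree : LoopFree hexagon₀
hexagon₀-loopFree {p} {q} e∈ = T-not⇒¬T (all⇒∀ (λ e → not (proj₁ e ≡ᵇ proj₂ e)) {hexagon₀} _ e∈) ∘ ℕ.≡⇒≡ᵇ p q

hasVertex : ℕ → List (ℕ × ℕ) → Bool
hasVertex d B = d ∈ᵇ vertices B

hexagonEmpty hexagonTrees hexagonTreesThrough₀ : (List (ℕ × ℕ) → Bool) → ℕ
hexagonEmpty         q = ∑[ B ∈ subsets hexagon₀ ] 𝟙 (null B ∧ q B)
hexagonTrees         q = ∑[ B ∈ subsets hexagon₀ ] 𝟙 (treeᵇ B ∧ q B)
hexagonTreesThrough₀ q = ∑[ B ∈ subsets hexagon₀ ] 𝟙 (treeThroughᵇ 0 B ∧ q B)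

hexagon-subtrees : hexagonEmpty (λ _ → true) ≡ 1 × hexagonTrees (λ _ → true) ≡ 30 × hexagonTreesThrough₀ (λ _ → true) ≡ 20
hexagon-subtrees = refl , refl , refl

hexagonLabel-+ : ∀ a m {d} → 1 ≤ d → m + d ≡ hexagonLabel a (1 + m) d
hexagonLabel-+ a m {suc d} _ = trans (ℕ.+-suc m d) (sym (hexagonLabel-suc a (1 + m) d))

module SpiroChain (d : ℕ) (1≤d : 1 ≤ d) (d≤5 : d ≤ 5) where

  edges : ℕ → List (ℕ × ℕ)
  edges n = E (spiroChain d n)

  cut first : ℕ → ℕ
  cut     = attach d
  first n = 1 + 5 * n

  cut≤ : ∀ n → cut n ≤ 5 * n
  cut≤ zero    = z≤n
  cut≤ (suc k) = ℕ.≤-trans (ℕ.+-monoʳ-≤ (5 * k) d≤5) (ℕ.≤-reflexive (trans (ℕ.+-comm (5 * k) 5) (sym (ℕ.*-suc 5 k))))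

  cut<first : ∀ n → cut n < first n
  cut<first n = s≤s (cut≤ n)

  label : ℕ → ℕ → ℕ
  label n = hexagonLabel (cut n) (first n)

  module Hex (n : ℕ) = Relabel (label n) (hexagonLabel-injective (cut<first n))

  hexagon : ℕ → List (ℕ × ℕ)
  hexagon n = map (Hex.relabel n) hexagon₀

  edges-suc : ∀ n → edges (suc n) ≡ edges n ++ hexagon n
  edges-suc n = begin
    concatMap hex (upTo (suc n))         ≡⟨ cong (concatMap hex) (List.upTo-∷ʳ n) ⟨
    concatMap hex (upTo n ++ n ∷ [])     ≡⟨ List.concatMap-++ hex (upTo n) (n ∷ []) ⟩
    edges n ++ hexagon n ++ []           ≡⟨ cong (edges n ++_) (List.++-identityʳ (hexagon n)) ⟩
    edges n ++ hexagon n ∎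
    where
    hex : ℕ → List (ℕ × ℕ)
    hex k = hexEdges (attach d k) (1 + 5 * k)

  hexagon-vertices : ∀ n {B} → B ⊆ hexagon₀ → ∀ {z} → z ∈ vertices (map (Hex.relabel n) B) →
                     ∃ λ i → i ≤ 5 × z ≡ label n i
  hexagon-vertices n {B} B⊆H p with ∈-map⁻ (label n) (subst (_ ∈_) (Hex.vertices-map n B) p)
  ... | i , i∈B , refl = i , hexagon₀-vertices-≤ (vertices-mono B⊆H i∈B) , refl

  edges-vertices-≤ : ∀ n {z} → z ∈ vertices (edges n) → z ≤ 5 * n
  edges-vertices-≤ (suc n) {z} p
    with ∈-++⁻ (vertices (edges n)) (subst (z ∈_) (trans (cong vertices (edges-suc n)) (vertices-++ (edges n) (hexagon n))) p)
  ... | inj₁ q = ℕ.≤-trans (edges-vertices-≤ n q) (ℕ.*-monoʳ-≤ 5 (ℕ.n≤1+n n))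
  ... | inj₂ q with hexagon-vertices n id q
  ...   | i , i≤5 , refl = ℕ.≤-trans (hexagonLabel-≤ (cut<first n) i≤5) (ℕ.≤-reflexive (lastLabel n))
    where
    lastLabel : ∀ n → first n + 4 ≡ 5 * suc n
    lastLabel n = trans (solve 1 (λ m → (con 1 :+ con 5 :* m) :+ con 4 := con 5 :+ con 5 :* m) refl n) (sym (ℕ.*-suc 5 n))

  meetOnlyAt : ∀ n {A B} → A ⊆ edges n → B ⊆ hexagon₀ → MeetOnlyAt A (map (Hex.relabel n) B) (cut n)
  meetOnlyAt n A⊆ B⊆H zA zB with hexagon-vertices n B⊆H zB
  ... | zero  , _ , refl = refl
  ... | suc i , _ , refl = ⊥-elim (ℕ.<⇒≱ newVertex (edges-vertices-≤ n (vertices-mono A⊆ zA)))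
    where
    newVertex : 5 * n < label n (suc i)
    newVertex rewrite hexagonLabel-suc (cut n) (first n) i = s≤s (ℕ.m≤m+n (5 * n) i)

  hexagon-loopFree : ∀ n {B} → B ⊆ hexagon₀ → LoopFree (map (Hex.relabel n) B)
  hexagon-loopFree n B⊆H e∈ with ∈-map⁻ (Hex.relabel n) e∈
  ... | (i , j) , ij∈B , refl = hexagon₀-loopFree (B⊆H ij∈B) ∘ hexagonLabel-injective (cut<first n)

  edges-loopFree : ∀ n → LoopFree (edges n)
  edges-loopFree (suc n) e∈ with ∈-++⁻ (edges n) (subst (_ ∈_) (edges-suc n) e∈)
  ... | inj₁ q = edges-loopFree n q
  ... | inj₂ q = hexagon-loopFree n id q

  cut-suc : ∀ n → cut (suc n) ≡ label n d
  cut-suc n = hexagonLabel-+ (cut n) (5 * n) 1≤d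

  glue : ℕ → List (ℕ × ℕ) → List (ℕ × ℕ) → List (ℕ × ℕ)
  glue n A B = A ++ map (Hex.relabel n) B

  ∑-subsets-edges-suc : ∀ n (G : List (ℕ × ℕ) → ℕ) →
    ∑ (subsets (edges (suc n))) G ≡ (∑[ A ∈ subsets (edges n) ] ∑[ B ∈ subsets hexagon₀ ] G (glue n A B))
  ∑-subsets-edges-suc n G = begin
    ∑ (subsets (edges (suc n))) G
      ≡⟨ cong (λ L → ∑ (subsets L) G) (edges-suc n) ⟩
    ∑ (subsets (edges n ++ hexagon n)) G
      ≡⟨ ∑-subsets-++ (edges n) (hexagon n) G ⟩
    (∑[ A ∈ subsets (edges n) ] ∑[ B′ ∈ subsets (hexagon n) ] G (A ++ B′))
      ≡⟨ ∑-cong (subsets (edges n)) (λ {A} _ → relabelled A) ⟩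
    (∑[ A ∈ subsets (edges n) ] ∑[ B ∈ subsets hexagon₀ ] G (glue n A B)) ∎
    where
    relabelled : ∀ A → (∑[ B′ ∈ subsets (hexagon n) ] G (A ++ B′)) ≡ (∑[ B ∈ subsets hexagon₀ ] G (glue n A B))
    relabelled A = ∑-subsets-map (Hex.relabel n) hexagon₀ (λ B′ → G (A ++ B′))

  𝟙-treeᵇ-glue : ∀ n (q : List (ℕ × ℕ) → Bool) {A B} → A ∈ subsets (edges n) → B ∈ subsets hexagon₀ →
    𝟙 (treeᵇ (glue n A B) ∧ q B)
      ≡ 𝟙 (treeᵇ A) * 𝟙 (null B ∧ q B) + 𝟙 (null A) * 𝟙 (treeᵇ B ∧ q B)
        + 𝟙 (treeThroughᵇ (cut n) A) * 𝟙 (treeThroughᵇ 0 B ∧ q B)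
  𝟙-treeᵇ-glue n q {A} {[]} _ _ = begin
    𝟙 (treeᵇ (A ++ []) ∧ q [])
      ≡⟨ cong (λ L → 𝟙 (treeᵇ L ∧ q [])) (List.++-identityʳ A) ⟩
    𝟙 (treeᵇ A ∧ q [])
      ≡⟨ 𝟙-∧ (treeᵇ A) (q []) ⟩
    𝟙 (treeᵇ A) * 𝟙 (q [])
      ≡⟨ solve 3 (λ x y z → x := x :+ y :* con 0 :+ z :* con 0) refl
           (𝟙 (treeᵇ A) * 𝟙 (q [])) (𝟙 (null A)) (𝟙 (treeThroughᵇ (cut n) A)) ⟩
    𝟙 (treeᵇ A) * 𝟙 (q []) + 𝟙 (null A) * 0 + 𝟙 (treeThroughᵇ (cut n) A) * 0 ∎
  𝟙-treeᵇ-glue n q {[]} {b ∷ B} _ _ = begin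
    𝟙 (treeᵇ (map (Hex.relabel n) (b ∷ B)) ∧ q (b ∷ B))
      ≡⟨ cong (λ t → 𝟙 (t ∧ q (b ∷ B))) (Hex.treeᵇ-map n (b ∷ B)) ⟩
    𝟙 (treeᵇ (b ∷ B) ∧ q (b ∷ B))
      ≡⟨ sym (trans (ℕ.+-identityʳ _) (ℕ.+-identityʳ _)) ⟩
    0 + (𝟙 (treeᵇ (b ∷ B) ∧ q (b ∷ B)) + 0) + 0 ∎
  𝟙-treeᵇ-glue n q {a ∷ A} {b ∷ B} A∈ B∈ = begin
    𝟙 (treeᵇ (glue n (a ∷ A) (b ∷ B)) ∧ qB)
      ≡⟨ cong (λ t → 𝟙 (t ∧ qB)) (treeᵇ-++ (meetOnlyAt n A⊆ B⊆)
           (LoopFree-⊆ A⊆ (edges-loopFree n)) (hexagon-loopFree n B⊆) (here refl) (here refl)) ⟩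
    𝟙 ((tA ∧ treeThroughᵇ (cut n) (map (Hex.relabel n) (b ∷ B))) ∧ qB)
      ≡⟨ cong (λ t → 𝟙 ((tA ∧ t) ∧ qB)) (Hex.treeThroughᵇ-map n 0 (b ∷ B)) ⟩
    𝟙 ((tA ∧ tB) ∧ qB)
      ≡⟨ cong 𝟙 (∧-assoc tA tB qB) ⟩
    𝟙 (tA ∧ (tB ∧ qB))
      ≡⟨ 𝟙-∧ tA (tB ∧ qB) ⟩
    𝟙 tA * 𝟙 (tB ∧ qB)
      ≡⟨ cong (_+ 𝟙 tA * 𝟙 (tB ∧ qB)) (sym (trans (ℕ.+-identityʳ _) (ℕ.*-zeroʳ (𝟙 (treeᵇ (a ∷ A)))))) ⟩
    𝟙 (treeᵇ (a ∷ A)) * 0 + 0 + 𝟙 tA * 𝟙 (tB ∧ qB) ∎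
    where
    A⊆ : a ∷ A ⊆ edges n
    A⊆ = subsets-⊆ (edges n) A∈
    B⊆ : b ∷ B ⊆ hexagon₀
    B⊆ = subsets-⊆ hexagon₀ B∈
    tA tB qB : Bool
    tA = treeThroughᵇ (cut n) (a ∷ A)
    tB = treeThroughᵇ 0 (b ∷ B)
    qB = q (b ∷ B)

  ∑-treeᵇ-glue : ∀ n (q : List (ℕ × ℕ) → Bool) (G : List (ℕ × ℕ) → ℕ) →
    (∀ {A B} → A ∈ subsets (edges n) → B ∈ subsets hexagon₀ → G (glue n A B) ≡ 𝟙 (treeᵇ (glue n A B) ∧ q B)) →
    ∑ (subsets (edges (suc n))) G
      ≡ edgeTrees (edges n) * hexagonEmpty q + hexagonTrees q + edgeTreesThrough (cut n) (edges n) * hexagonTreesThrough₀ q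
  ∑-treeᵇ-glue n q G G-glue = begin
    ∑ (subsets (edges (suc n))) G
      ≡⟨ ∑-subsets-edges-suc n G ⟩
    (∑[ A ∈ As ] ∑[ B ∈ Bs ] G (glue n A B))
      ≡⟨ ∑-cong As (λ A∈ → ∑-cong Bs (λ B∈ → trans (G-glue A∈ B∈) (𝟙-treeᵇ-glue n q A∈ B∈))) ⟩
    (∑[ A ∈ As ] ∑[ B ∈ Bs ] (𝟙 (treeᵇ A) * 𝟙 (null B ∧ q B) + 𝟙 (null A) * 𝟙 (treeᵇ B ∧ q B)
                                + 𝟙 (treeThroughᵇ (cut n) A) * 𝟙 (treeThroughᵇ 0 B ∧ q B)))
      ≡⟨ ∑-cong As (λ {A} _ → inner A) ⟩
    (∑[ A ∈ As ] (𝟙 (treeᵇ A) * hexagonEmpty q + 𝟙 (null A) * hexagonTrees q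
                  + 𝟙 (treeThroughᵇ (cut n) A) * hexagonTreesThrough₀ q))
      ≡⟨ ∑-+₃ As _ _ _ ⟩
    (∑[ A ∈ As ] 𝟙 (treeᵇ A) * hexagonEmpty q) + (∑[ A ∈ As ] 𝟙 (null A) * hexagonTrees q)
      + (∑[ A ∈ As ] 𝟙 (treeThroughᵇ (cut n) A) * hexagonTreesThrough₀ q)
      ≡⟨ cong₂ (λ x y → x + y + (∑[ A ∈ As ] 𝟙 (treeThroughᵇ (cut n) A) * hexagonTreesThrough₀ q))
               (∑-*ʳ As _ (𝟙 ∘ treeᵇ)) (∑-*ʳ As _ (𝟙 ∘ null)) ⟩
    edgeTrees (edges n) * hexagonEmpty q + (∑[ A ∈ As ] 𝟙 (null A)) * hexagonTrees q
      + (∑[ A ∈ As ] 𝟙 (treeThroughᵇ (cut n) A) * hexagonTreesThrough₀ q)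
      ≡⟨ cong₂ (λ x y → edgeTrees (edges n) * hexagonEmpty q + x + y)
               (trans (cong (_* hexagonTrees q) (∑-subsets-null (edges n))) (ℕ.*-identityˡ _))
               (∑-*ʳ As _ (𝟙 ∘ treeThroughᵇ (cut n))) ⟩
    edgeTrees (edges n) * hexagonEmpty q + hexagonTrees q + edgeTreesThrough (cut n) (edges n) * hexagonTreesThrough₀ q ∎
    where
    As Bs : List (List (ℕ × ℕ))
    As = subsets (edges n)
    Bs = subsets hexagon₀
    inner : ∀ A → (∑[ B ∈ Bs ] (𝟙 (treeᵇ A) * 𝟙 (null B ∧ q B) + 𝟙 (null A) * 𝟙 (treeᵇ B ∧ q B)
                                 + 𝟙 (treeThroughᵇ (cut n) A) * 𝟙 (treeThroughᵇ 0 B ∧ q B)))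
                ≡ 𝟙 (treeᵇ A) * hexagonEmpty q + 𝟙 (null A) * hexagonTrees q
                  + 𝟙 (treeThroughᵇ (cut n) A) * hexagonTreesThrough₀ q
    inner A = trans (∑-+₃ Bs (λ B → 𝟙 (treeᵇ A) * 𝟙 (null B ∧ q B)) (λ B → 𝟙 (null A) * 𝟙 (treeᵇ B ∧ q B))
                              (λ B → 𝟙 (treeThroughᵇ (cut n) A) * 𝟙 (treeThroughᵇ 0 B ∧ q B)))
      (cong₂ _+_ (cong₂ _+_ (∑-*ˡ Bs (𝟙 (treeᵇ A)) (λ B → 𝟙 (null B ∧ q B)))
                            (∑-*ˡ Bs (𝟙 (null A)) (λ B → 𝟙 (treeᵇ B ∧ q B))))
                 (∑-*ˡ Bs (𝟙 (treeThroughᵇ (cut n) A)) (λ B → 𝟙 (treeThroughᵇ 0 B ∧ q B))))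

  edgeTrees-suc : ∀ n → edgeTrees (edges (suc n))
    ≡ edgeTrees (edges n) * hexagonEmpty (λ _ → true) + hexagonTrees (λ _ → true)
      + edgeTreesThrough (cut n) (edges n) * hexagonTreesThrough₀ (λ _ → true)
  edgeTrees-suc n = ∑-treeᵇ-glue n (λ _ → true) (𝟙 ∘ treeᵇ) (λ _ _ → cong 𝟙 (sym (∧-identityʳ _)))

  edgeTreesThrough-suc : ∀ n → edgeTreesThrough (cut (suc n)) (edges (suc n))
    ≡ edgeTrees (edges n) * hexagonEmpty (hasVertex d) + hexagonTrees (hasVertex d)
      + edgeTreesThrough (cut n) (edges n) * hexagonTreesThrough₀ (hasVertex d)
  edgeTreesThrough-suc n = ∑-treeᵇ-glue n (hasVertex d) (𝟙 ∘ treeThroughᵇ (cut (suc n)))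
    (λ {A} {B} A∈ _ → cong (λ t → 𝟙 (treeᵇ (glue n A B) ∧ t)) (begin
      cut (suc n) ∈ᵇ vertices (A ++ map (Hex.relabel n) B)
        ≡⟨ cong (cut (suc n) ∈ᵇ_) (vertices-++ A _) ⟩
      cut (suc n) ∈ᵇ (vertices A ++ vertices (map (Hex.relabel n) B))
        ≡⟨ ∈ᵇ-++ (cut (suc n)) (vertices A) _ ⟩
      (cut (suc n) ∈ᵇ vertices A) ∨ (cut (suc n) ∈ᵇ vertices (map (Hex.relabel n) B))
        ≡⟨ cong₂ _∨_ (T-false (next-cut∉ A∈ ∘ ∈ᵇ⇒∈ (vertices A))) (cong (_∈ᵇ vertices (map (Hex.relabel n) B)) (cut-suc n)) ⟩
      label n d ∈ᵇ vertices (map (Hex.relabel n) B)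
        ≡⟨ cong (label n d ∈ᵇ_) (Hex.vertices-map n B) ⟩
      label n d ∈ᵇ map (label n) (vertices B)
        ≡⟨ Hex.∈ᵇ-map n d (vertices B) ⟩
      d ∈ᵇ vertices B ∎))
    where
    next-cut∉ : ∀ {A} → A ∈ subsets (edges n) → ¬ cut (suc n) ∈ vertices A
    next-cut∉ {A} A∈ p = ℕ.<⇒≱ (ℕ.≤-trans (ℕ.≤-reflexive (ℕ.+-comm 1 (5 * n))) (ℕ.+-monoʳ-≤ (5 * n) 1≤d))
      (edges-vertices-≤ n (vertices-mono (subsets-⊆ (edges n) A∈) p))

  STN-spiroChain : ∀ n → STN (spiroChain d n) ≡ (5 * n + 1) + edgeTrees (edges n)
  STN-spiroChain n = STN-edgeTrees (spiroChain d n) (λ p → ∈-upTo⁺ (s≤s′ (edges-vertices-≤ n p)))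
    where
    s≤s′ : ∀ {z} → z ≤ 5 * n → z < 5 * n + 1
    s≤s′ {z} z≤ = subst (z <_) (ℕ.+-comm 1 (5 * n)) (s≤s z≤)

suc-pred-^ : ∀ b m → suc (suc b ^ m ∸ 1) ≡ suc b ^ m
suc-pred-^ b m = ℕ.m+[n∸m]≡n (ℕ.m^n>0 (suc b) m)

module ChainRecurrence (j : ℕ) (N C : ℕ → ℕ) (N-zero : N 0 ≡ 0) (C-zero : C 0 ≡ 0)
                       (N-suc : ∀ n → N (suc n) ≡ N n + 30 + C n * 20)
                       (C-suc : ∀ n → C (suc n) ≡ 20 + C n * suc j) where

  S : ℕ → ℕ
  S n = (5 * n + 1) + N n

  C-closed : ∀ m → j * C (suc m) + 20 ≡ 20 * suc j ^ suc m
  C-closed zero rewrite C-suc 0 | C-zero = solve 1 (λ j → j :* (con 20 :+ con 0) :+ con 20 := con 20 :* ((con 1 :+ j) :* con 1)) refl j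
  C-closed (suc m) = begin
    j * C (suc (suc m)) + 20      ≡⟨ cong (λ t → j * t + 20) (C-suc (suc m)) ⟩
    j * (20 + C (suc m) * suc j) + 20
      ≡⟨ solve 2 (λ j c → j :* (con 20 :+ c :* (con 1 :+ j)) :+ con 20 := (con 1 :+ j) :* (j :* c :+ con 20)) refl j (C (suc m)) ⟩
    suc j * (j * C (suc m) + 20)  ≡⟨ cong (suc j *_) (C-closed m) ⟩
    suc j * (20 * suc j ^ suc m)  ≡⟨ solve 2 (λ k p → k :* (con 20 :* p) := con 20 :* (k :* p)) refl (suc j) (suc j ^ suc m) ⟩
    20 * suc j ^ suc (suc m)      ∎

  -- The closed form of S (suc m), multiplied by j * j so that it holds in ℕ.
  S-closed : ∀ m → j * j * S (suc m) + 400 * j * suc m + 400 ≡ j * j * (35 * m + 36) + 400 * suc j ^ suc m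
  S-closed zero rewrite N-suc 0 | N-zero | C-zero =
    solve 1 (λ j → j :* j :* (con 6 :+ con 30) :+ con 400 :* j :* con 1 :+ con 400
                   := j :* j :* con 36 :+ con 400 :* ((con 1 :+ j) :* con 1)) refl j
  S-closed (suc m) = begin
    j * j * S (suc (suc m)) + 400 * j * suc (suc m) + 400
      ≡⟨ cong (λ t → j * j * (5 * suc (suc m) + 1 + t) + 400 * j * suc (suc m) + 400) (N-suc (suc m)) ⟩
    j * j * (5 * suc (suc m) + 1 + (N (suc m) + 30 + C (suc m) * 20)) + 400 * j * suc (suc m) + 400
      ≡⟨ solve 4 (λ j m n c →
           j :* j :* (con 5 :* (con 2 :+ m) :+ con 1 :+ (n :+ con 30 :+ c :* con 20)) :+ con 400 :* j :* (con 2 :+ m) :+ con 400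
           := (j :* j :* (con 5 :* (con 1 :+ m) :+ con 1 :+ n) :+ con 400 :* j :* (con 1 :+ m) :+ con 400)
              :+ con 35 :* j :* j :+ con 20 :* j :* (j :* c :+ con 20)) refl j m (N (suc m)) (C (suc m)) ⟩
    (j * j * S (suc m) + 400 * j * suc m + 400) + 35 * j * j + 20 * j * (j * C (suc m) + 20)
      ≡⟨ cong₂ (λ x y → x + 35 * j * j + 20 * j * y) (S-closed m) (C-closed m) ⟩
    (j * j * (35 * m + 36) + 400 * suc j ^ suc m) + 35 * j * j + 20 * j * (20 * suc j ^ suc m)
      ≡⟨ solve 3 (λ j m p →
           (j :* j :* (con 35 :* m :+ con 36) :+ con 400 :* p) :+ con 35 :* j :* j :+ con 20 :* j :* (con 20 :* p)
           := j :* j :* (con 35 :* (con 1 :+ m) :+ con 36) :+ con 400 :* ((con 1 :+ j) :* p)) refl j m (suc j ^ suc m) ⟩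
    j * j * (35 * suc m + 36) + 400 * suc j ^ suc (suc m) ∎

ortho-arithmetic : ∀ s m → 15 * 15 * s + 400 * 15 * suc m + 400 ≡ 15 * 15 * (35 * m + 36) + 400 * 16 ^ suc m →
                   9 * s ≡ 256 * (16 ^ m ∸ 1) + 3 * 25 * m + 9 * 36
ortho-arithmetic s m h = ℕ.*-cancelˡ-≡ _ _ 25 (ℕ.+-cancelʳ-≡ (6000 * suc m + 400) _ _ (begin
  25 * (9 * s) + (6000 * suc m + 400)
    ≡⟨ solve 2 (λ s m → con 25 :* (con 9 :* s) :+ (con 6000 :* (con 1 :+ m) :+ con 400)
                        := con 15 :* con 15 :* s :+ con 400 :* con 15 :* (con 1 :+ m) :+ con 400) refl s m ⟩
  15 * 15 * s + 400 * 15 * suc m + 400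
    ≡⟨ h ⟩
  15 * 15 * (35 * m + 36) + 400 * (16 * 16 ^ m)
    ≡⟨ cong (λ t → 15 * 15 * (35 * m + 36) + 400 * (16 * t)) (sym (suc-pred-^ 15 m)) ⟩
  15 * 15 * (35 * m + 36) + 400 * (16 * suc (16 ^ m ∸ 1))
    ≡⟨ solve 2 (λ m y → con 15 :* con 15 :* (con 35 :* m :+ con 36) :+ con 400 :* (con 16 :* (con 1 :+ y))
                        := con 25 :* (con 256 :* y :+ con 3 :* con 25 :* m :+ con 9 :* con 36)
                           :+ (con 6000 :* (con 1 :+ m) :+ con 400)) refl m (16 ^ m ∸ 1) ⟩
  25 * (256 * (16 ^ m ∸ 1) + 3 * 25 * m + 9 * 36) + (6000 * suc m + 400) ∎))

meta-arithmetic : ∀ s m → 12 * 12 * s + 400 * 12 * suc m + 400 ≡ 12 * 12 * (35 * m + 36) + 400 * 13 ^ suc m →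
                  9 * s ≡ 325 * (13 ^ m ∸ 1) + 3 * 5 * m + 9 * 36
meta-arithmetic s m h = ℕ.*-cancelˡ-≡ _ _ 16 (ℕ.+-cancelʳ-≡ (4800 * suc m + 400) _ _ (begin
  16 * (9 * s) + (4800 * suc m + 400)
    ≡⟨ solve 2 (λ s m → con 16 :* (con 9 :* s) :+ (con 4800 :* (con 1 :+ m) :+ con 400)
                        := con 12 :* con 12 :* s :+ con 400 :* con 12 :* (con 1 :+ m) :+ con 400) refl s m ⟩
  12 * 12 * s + 400 * 12 * suc m + 400
    ≡⟨ h ⟩
  12 * 12 * (35 * m + 36) + 400 * (13 * 13 ^ m)
    ≡⟨ cong (λ t → 12 * 12 * (35 * m + 36) + 400 * (13 * t)) (sym (suc-pred-^ 12 m)) ⟩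
  12 * 12 * (35 * m + 36) + 400 * (13 * suc (13 ^ m ∸ 1))
    ≡⟨ solve 2 (λ m y → con 12 :* con 12 :* (con 35 :* m :+ con 36) :+ con 400 :* (con 13 :* (con 1 :+ y))
                        := con 16 :* (con 325 :* y :+ con 3 :* con 5 :* m :+ con 9 :* con 36)
                           :+ (con 4800 :* (con 1 :+ m) :+ con 400)) refl m (13 ^ m ∸ 1) ⟩
  16 * (325 * (13 ^ m ∸ 1) + 3 * 5 * m + 9 * 36) + (4800 * suc m + 400) ∎))

para-arithmetic : ∀ s m → 11 * 11 * s + 400 * 11 * suc m + 400 ≡ 11 * 11 * (35 * m + 36) + 400 * 12 ^ suc m →
                  121 * s + 11 * 15 * m ≡ 4800 * (12 ^ m ∸ 1) + 121 * 36
para-arithmetic s m h = ℕ.+-cancelʳ-≡ (4235 * m + 4800) _ _ (begin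
  121 * s + 11 * 15 * m + (4235 * m + 4800)
    ≡⟨ solve 2 (λ s m → con 121 :* s :+ con 11 :* con 15 :* m :+ (con 4235 :* m :+ con 4800)
                        := con 11 :* con 11 :* s :+ con 400 :* con 11 :* (con 1 :+ m) :+ con 400) refl s m ⟩
  11 * 11 * s + 400 * 11 * suc m + 400
    ≡⟨ h ⟩
  11 * 11 * (35 * m + 36) + 400 * (12 * 12 ^ m)
    ≡⟨ cong (λ t → 11 * 11 * (35 * m + 36) + 400 * (12 * t)) (sym (suc-pred-^ 11 m)) ⟩
  11 * 11 * (35 * m + 36) + 400 * (12 * suc (12 ^ m ∸ 1))
    ≡⟨ solve 2 (λ m y → con 11 :* con 11 :* (con 35 :* m :+ con 36) :+ con 400 :* (con 12 :* (con 1 :+ y))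
                        := con 4800 :* y :+ con 121 :* con 36 :+ (con 4235 :* m :+ con 4800)) refl m (12 ^ m ∸ 1) ⟩
  4800 * (12 ^ m ∸ 1) + 121 * 36 + (4235 * m + 4800) ∎)

module ClosedForm (d : ℕ) (1≤d : 1 ≤ d) (d≤5 : d ≤ 5) (j : ℕ)
  (empty : hexagonEmpty (hasVertex d) ≡ 0) (trees : hexagonTrees (hasVertex d) ≡ 20)
  (through : hexagonTreesThrough₀ (hasVertex d) ≡ suc j) where

  open SpiroChain d 1≤d d≤5

  private
    N C : ℕ → ℕ
    N n = edgeTrees (edges n)
    C n = edgeTreesThrough (cut n) (edges n)

    N-suc : ∀ n → N (suc n) ≡ N n + 30 + C n * 20
    N-suc n = begin
      N (suc n)
        ≡⟨ edgeTrees-suc n ⟩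
      N n * hexagonEmpty always + hexagonTrees always + C n * hexagonTreesThrough₀ always
        ≡⟨ cong₂ (λ x y → N n * x + y + C n * hexagonTreesThrough₀ always) (proj₁ hexagon-subtrees) (proj₁ (proj₂ hexagon-subtrees)) ⟩
      N n * 1 + 30 + C n * hexagonTreesThrough₀ always
        ≡⟨ cong₂ (λ x y → x + 30 + C n * y) (ℕ.*-identityʳ (N n)) (proj₂ (proj₂ hexagon-subtrees)) ⟩
      N n + 30 + C n * 20 ∎
      where
      always : List (ℕ × ℕ) → Bool
      always _ = true

    C-suc : ∀ n → C (suc n) ≡ 20 + C n * suc j
    C-suc n = begin
      C (suc n)
        ≡⟨ edgeTreesThrough-suc n ⟩
      N n * hexagonEmpty (hasVertex d) + hexagonTrees (hasVertex d) + C n * hexagonTreesThrough₀ (hasVertex d)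
        ≡⟨ cong₂ (λ x y → N n * x + y + C n * hexagonTreesThrough₀ (hasVertex d)) empty trees ⟩
      N n * 0 + 20 + C n * hexagonTreesThrough₀ (hasVertex d)
        ≡⟨ cong₂ (λ x y → x + 20 + C n * y) (ℕ.*-zeroʳ (N n)) through ⟩
      20 + C n * suc j ∎

  open ChainRecurrence j N C refl refl N-suc C-suc

  STN-closed : ∀ m → j * j * STN (spiroChain d (suc m)) + 400 * j * suc m + 400
                     ≡ j * j * (35 * m + 36) + 400 * suc j ^ suc m
  STN-closed m = subst (λ t → j * j * t + 400 * j * suc m + 400 ≡ j * j * (35 * m + 36) + 400 * suc j ^ suc m)
                       (sym (STN-spiroChain (suc m))) (S-closed m)

module Ortho = ClosedForm 1 (ℕ.≤ᵇ⇒≤ 1 1 _) (ℕ.≤ᵇ⇒≤ 1 5 _) 15 refl refl refl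
module Meta  = ClosedForm 2 (ℕ.≤ᵇ⇒≤ 1 2 _) (ℕ.≤ᵇ⇒≤ 2 5 _) 12 refl refl refl
module Para  = ClosedForm 3 (ℕ.≤ᵇ⇒≤ 1 3 _) (ℕ.≤ᵇ⇒≤ 3 5 _) 11 refl refl refl

corollary3p2 : (n : ℕ) → 1 ≤ n →
      (9 * STN (O n) ≡ 256 * (16 ^ (n ∸ 1) ∸ 1) + 3 * 25 * (n ∸ 1) + 9 * 36)
    × (9 * STN (M n) ≡ 325 * (13 ^ (n ∸ 1) ∸ 1) + 3 * 5 * (n ∸ 1) + 9 * 36)
    × (121 * STN (P n) + 11 * 15 * (n ∸ 1) ≡ 4800 * (12 ^ (n ∸ 1) ∸ 1) + 121 * 36)
corollary3p2 (suc m) _ =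
    ortho-arithmetic (STN (O (suc m))) m (Ortho.STN-closed m)
  , meta-arithmetic (STN (M (suc m))) m (Meta.STN-closed m)
  , para-arithmetic (STN (P (suc m))) m (Para.STN-closed m)
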